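{- Let $G$ be an equatorial graph with girth $g$ and equator $q$, let $k=\lceil g/2\rceil-1$, let $C=u_0,\dots,u_{q-1}$ be an isometric cycle of length $q$ in $G$, and let $L_i=\mathcal{D}_k(u_{i-k})\cap\mathcal{D}_k(u_{i+k})$ for $i\in\{0,\dots,q-1\}$ (indices mod $q$). Then $|L_i|=|L_{i+g}|$ for all $i$ (indices mod $q$).
   Context: For a vertex $u$, $\mathcal{D}_i(u)=\{v: d(u,v)\le i\}$. A cycle $C$ is isometric if $d_C(x,y)=d_G(x,y)$ for all $x,y\in V(C)$; the equator is the length of a longest isometric cycle. For $\delta\ge2$, $g\ge3$, $k=\lceil g/2\rceil-1$, the Moore bound is $M(\delta,g)=1+\sum_{i=0}^{k-1}\delta(\delta-1)^i$ for odd $g$ and $M(\delta,g)=2+\sum_{i=1}^{k}2(\delta-1)^i$ for even $g$. An equatorial graph is a finite graph with girth $g$, minimum degree $\delta$ and equator $q>6k+3$ whose order is exactly $\frac{q}{g}M(\delta,g)$. -}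

module Defs where

open import Data.Nat using (ℕ; zero; suc; _+_; _*_; _∸_; _^_; _≤_; _<_; ∣_-_∣; _⊓_; ⌊_/2⌋)
open import Data.Bool using (Bool; true; false; _∧_; _∨_; if_then_else_)
open import Data.Fin using (Fin; _≟_)
open import Data.List using (List; map; allFin)
open import Data.Nat.ListAction using (sum)
open import Data.Bool.ListAction using (any)
open import Data.Product using (Σ; ∃; _×_)
open import Data.Sum using (_⊎_)
open import Relation.Nullary.Decidable using (⌊_⌋)
open import Relation.Binary.PropositionalEquality using (_≡_)

record Graph : Set where
  field
    n      : ℕ
    adj    : Fin n → Fin n → Bool
    sym    : ∀ u v → adj u v ≡ adj v u
    irrefl : ∀ u → adj u u ≡ false

module _ (G : Graph) where
  open Graph G

  count : {A : Set} → (A → Bool) → List A → ℕ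
  count p xs = sum (map (λ x → if p x then 1 else 0) xs)

  deg : Fin n → ℕ
  deg u = count (adj u) (allFin n)

  -- within i u v = true  iff  d(u,v) ≤ i   (i.e. v ∈ 𝒟_i(u))
  within : ℕ → Fin n → Fin n → Bool
  within zero u v = ⌊ u ≟ v ⌋
  within (suc i) u v = within i u v ∨ any (λ w → within i u w ∧ adj w v) (allFin n)

  Dist : Fin n → Fin n → ℕ → Set
  Dist u v zero = within zero u v ≡ true
  Dist u v (suc m) = (within (suc m) u v ≡ true) × (within m u v ≡ false)

  MinDegree : ℕ → Set
  MinDegree δ = (∀ u → δ ≤ deg u) × ∃ λ u → deg u ≡ δ

  record Cycle (ℓ : ℕ) : Set where
    field
      vert     : ℕ → Fin n
      len≥3    : 3 ≤ ℓ
      periodic : ∀ i → vert (i + ℓ) ≡ vert i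
      inj      : ∀ i j → i < ℓ → j < ℓ → vert i ≡ vert j → i ≡ j
      edges    : ∀ i → adj (vert i) (vert (suc i)) ≡ true

  cycDist : ℕ → ℕ → ℕ → ℕ
  cycDist ℓ i j = ∣ i - j ∣ ⊓ (ℓ ∸ ∣ i - j ∣)

  Isometric : ∀ {ℓ} → Cycle ℓ → Set
  Isometric {ℓ} C = ∀ i j → i < ℓ → j < ℓ →
    Dist (Cycle.vert C i) (Cycle.vert C j) (cycDist ℓ i j)

  Girth : ℕ → Set
  Girth g = Cycle g × (∀ ℓ → Cycle ℓ → g ≤ ℓ)

  Equator : ℕ → Set
  Equator q = (Σ (Cycle q) Isometric) × (∀ ℓ (C : Cycle ℓ) → Isometric C → ℓ ≤ q)

-- k = ⌈g/2⌉ - 1  (= ⌊(g-1)/2⌋)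
kOf : ℕ → ℕ
kOf g = ⌊ suc g /2⌋ ∸ 1

sumFrom : ℕ → ℕ → (ℕ → ℕ) → ℕ
sumFrom a zero f = 0
sumFrom a (suc m) f = f a + sumFrom (suc a) m f

isOdd : ℕ → Bool
isOdd zero = false
isOdd (suc zero) = true
isOdd (suc (suc m)) = isOdd m

moore : ℕ → ℕ → ℕ
moore δ g = if isOdd g
  then 1 + sumFrom 0 (kOf g) (λ i → δ * (δ ∸ 1) ^ i)
  else 2 + sumFrom 1 (kOf g) (λ i → 2 * (δ ∸ 1) ^ i)

-- G is equatorial with girth g, minimum degree δ, equator q:
-- q > 6k+3 and order n = (q/g)·M(δ,g), i.e. n·g = q·M(δ,g).
Equatorial : (G : Graph) (δ g q : ℕ) → Set
Equatorial G δ g q =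
  2 ≤ δ × 3 ≤ g × MinDegree G δ × Girth G g × Equator G q ×
  6 * kOf g + 3 < q ×
  Graph.n G * g ≡ q * moore δ g

Lsize : (G : Graph) (k q : ℕ) → Cycle G q → ℕ → ℕ
Lsize G k q C i =
  count G (λ v → within G k (Cycle.vert C (i + q ∸ k)) v ∧ within G k (Cycle.vert C (i + k)) v)
          (allFin (Graph.n G))

-- Let f_v(j) say that the vertex v is within distance k of u_j. As C is isometric, the
-- positions j with f_v(j) lie in an arc of at most 2k + 1 consecutive positions (mod q). Let
-- E_j be the k-ball around u_j if g is odd, and the union of the k-balls around u_{j-1} and u_j
-- if g is even. Then every vertex lies in E_j for at most g positions j of a period, while the
-- Moore bound gives |E_j| ≥ M(δ,g). Since n·g = q·M(δ,g), double counting forces |E_j| = M(δ,g)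
-- for all j, and every vertex v to lie in E_j exactly for the j of an arc [r, r + g); such a v
-- belongs to L_c exactly when c ≡ r + k. Between E_{c+g-k-1} and E_{c+g-k}, which have the same
-- size, the vertices that leave are those of L_c and those that enter are those of L_{c+g}.
module Submission where

open import Defs
open import Data.Nat using (ℕ; _+_; _<_)
open import Relation.Binary.PropositionalEquality using (_≡_)

open import Data.Bool.Base using (Bool; true; false; _∧_; _∨_; not; if_then_else_; T)
open import Data.Bool.ListAction using (any)
open import Data.Bool.Properties using (T-≡; ∧-conicalˡ; ∧-conicalʳ; ∧-zeroʳ; ∨-zeroʳ; ∨-identityʳ; ¬-not)
  renaming (_≟_ to _≟ᵇ_)
open import Data.Empty using (⊥; ⊥-elim)
open import Data.Fin.Base using (Fin)
open import Data.Fin using (_≟_)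
open import Data.List.Base using (List; []; _∷_; map; length; allFin; applyUpTo; upTo; _∷ʳ_)
open import Data.List.Membership.Propositional using (_∈_; find; lose)
open import Data.List.Membership.Propositional.Properties using (∈-allFin; ∈-upTo⁺)
open import Data.List.Properties
  using (map-cong; map-cong-local; map-upTo; applyUpTo-∷ʳ; length-upTo; length-tabulate)
open import Data.List.Relation.Unary.All as All using (All; []; _∷_)
open import Data.List.Relation.Unary.AllPairs as AllPairs using (AllPairs; []; _∷_)
open import Data.List.Relation.Unary.Any.Properties using (any⁺; any⁻)
open import Data.List.Relation.Unary.Unique.Propositional.Properties using (allFin⁺)
open import Data.Maybe.Base using (Maybe; just; nothing)
open import Data.Nat.Base
open import Data.Nat.DivMod
  using (_%_; _/_; m≡m%n+[m/n]*n; m%n<n; [m+n]%n≡m%n; m<n⇒m%n≡m; %-distribˡ-+; n%n≡0)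
open import Data.Nat.ListAction using (sum)
open import Data.Nat.ListAction.Properties using (sum-++)
open import Data.Nat.Properties hiding (_≟_)
open import Data.Nat.Properties using () renaming (_≟_ to _≟ℕ_)
open import Data.Nat.Tactic.RingSolver using (solve-∀)
open import Data.Product.Base using (∃; _×_; _,_; proj₁; proj₂)
open import Data.Sum.Base using (_⊎_; inj₁; inj₂; [_,_]′; swap)
open import Data.Unit.Base using (⊤; tt)
open import Function.Base using (_∘_)
open import Function.Bundles using (_⇔_; mk⇔; Equivalence)
open import Relation.Binary.Definitions using (tri<; tri≈; tri>)
open import Relation.Binary.PropositionalEquality
open import Relation.Nullary using (¬_; yes; no)
open import Relation.Nullary.Decidable using (⌊_⌋; dec-true; isYes≗does; toWitness; _×-dec_)
open import Relation.Unary using (Decidable)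
open import Algebra.Properties.CommutativeSemigroup +-commutativeSemigroup
  using () renaming (interchange to +-interchange)

open Equivalence using (to; from)

-- Counting

⟦_⟧ : Bool → ℕ
⟦ b ⟧ = if b then 1 else 0

⟦∨⟧ : ∀ {a b} → (a ≡ true → b ≡ true → ⊥) → ⟦ a ∨ b ⟧ ≡ ⟦ a ⟧ + ⟦ b ⟧
⟦∨⟧ {true}  {true}  excl = ⊥-elim (excl refl refl)
⟦∨⟧ {true}  {false} _    = refl
⟦∨⟧ {false}         _    = refl

countᵇ : {A : Set} → (A → Bool) → List A → ℕ
countᵇ p xs = sum (map (λ x → ⟦ p x ⟧) xs)

module _ {A : Set} where

  any-≡true⁻ : (p : A → Bool) (xs : List A) → any p xs ≡ true → ∃ λ x → x ∈ xs × p x ≡ true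
  any-≡true⁻ p xs e with x , x∈xs , px ← find (any⁻ p xs (from T-≡ e)) = x , x∈xs , to T-≡ px

  any-≡true⁺ : (p : A → Bool) (xs : List A) {x : A} → x ∈ xs → p x ≡ true → any p xs ≡ true
  any-≡true⁺ p xs x∈xs px = to T-≡ (any⁺ p (lose x∈xs (from T-≡ px)))

  sum-map-+ : (f h : A → ℕ) (xs : List A) →
              sum (map (λ x → f x + h x) xs) ≡ sum (map f xs) + sum (map h xs)
  sum-map-+ f h []       = refl
  sum-map-+ f h (x ∷ xs) = begin
    f x + h x + sum (map (λ x → f x + h x) xs)     ≡⟨ cong (f x + h x +_) (sum-map-+ f h xs) ⟩
    f x + h x + (sum (map f xs) + sum (map h xs))  ≡⟨ +-interchange (f x) (h x) _ _ ⟩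
    f x + sum (map f xs) + (h x + sum (map h xs))  ∎
    where open ≡-Reasoning

  sum-map-mono-≤ : {f h : A → ℕ} → (∀ x → f x ≤ h x) → (xs : List A) → sum (map f xs) ≤ sum (map h xs)
  sum-map-mono-≤ f≤h []       = z≤n
  sum-map-mono-≤ f≤h (x ∷ xs) = +-mono-≤ (f≤h x) (sum-map-mono-≤ f≤h xs)

  sum-map-≤-const : {f : A → ℕ} {c : ℕ} → (∀ x → f x ≤ c) → (xs : List A) → sum (map f xs) ≤ length xs * c
  sum-map-≤-const f≤c []       = z≤n
  sum-map-≤-const f≤c (x ∷ xs) = +-mono-≤ (f≤c x) (sum-map-≤-const f≤c xs)

  sum-map-const : (c : ℕ) (xs : List A) → sum (map (λ _ → c) xs) ≡ length xs * c
  sum-map-const c []       = refl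
  sum-map-const c (x ∷ xs) = cong (c +_) (sum-map-const c xs)

  sum-map-equality : {f h : A → ℕ} → (∀ x → f x ≤ h x) → (xs : List A) →
                     sum (map h xs) ≤ sum (map f xs) → All (λ x → f x ≡ h x) xs
  sum-map-equality f≤h []       _ = []
  sum-map-equality {f} {h} f≤h (x ∷ xs) h≤f =
    ≤-antisym (f≤h x) hx≤fx ∷ sum-map-equality f≤h xs rest≤
    where
    hx≤fx : h x ≤ f x
    hx≤fx = +-cancelʳ-≤ _ _ _ (≤-trans h≤f (+-monoʳ-≤ (f x) (sum-map-mono-≤ f≤h xs)))
    rest≤ : sum (map h xs) ≤ sum (map f xs)
    rest≤ = +-cancelˡ-≤ (h x) _ _ (≤-trans h≤f (+-monoˡ-≤ _ (f≤h x)))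

  ⟦⟧-mono : ∀ {a b} → (a ≡ true → b ≡ true) → ⟦ a ⟧ ≤ ⟦ b ⟧
  ⟦⟧-mono {false} _   = z≤n
  ⟦⟧-mono {true}  a⇒b rewrite a⇒b refl = ≤-refl

  countᵇ-mono : {p r : A → Bool} → (∀ x → p x ≡ true → r x ≡ true) →
                (xs : List A) → countᵇ p xs ≤ countᵇ r xs
  countᵇ-mono p⇒r = sum-map-mono-≤ (λ x → ⟦⟧-mono (p⇒r x))

  countᵇ-∨ : {p r : A → Bool} → (∀ x → p x ≡ true → r x ≡ true → ⊥) → (xs : List A) →
             countᵇ (λ x → p x ∨ r x) xs ≡ countᵇ p xs + countᵇ r xs
  countᵇ-∨ excl xs = trans (cong sum (map-cong (λ x → ⟦∨⟧ (excl x)) xs)) (sum-map-+ _ _ xs)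

  countᵇ-∧ˡ : (b : Bool) (p : A → Bool) (xs : List A) →
              countᵇ (λ x → b ∧ p x) xs ≡ (if b then countᵇ p xs else 0)
  countᵇ-∧ˡ true  p xs = refl
  countᵇ-∧ˡ false p xs = trans (sum-map-const 0 xs) (*-zeroʳ (length xs))

  countᵇ-≤-∧-not : (p e : A → Bool) (xs : List A) →
                   countᵇ p xs ≤ countᵇ (λ x → p x ∧ not (e x)) xs + countᵇ e xs
  countᵇ-≤-∧-not p e xs = ≤-trans (countᵇ-mono split xs) (≤-reflexive (countᵇ-∨ excl xs))
    where
    split : ∀ x → p x ≡ true → (p x ∧ not (e x)) ∨ e x ≡ true
    split x px rewrite px with e x
    ... | true  = refl
    ... | false = refl
    excl : ∀ x → p x ∧ not (e x) ≡ true → e x ≡ true → ⊥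
    excl x p∧¬e ex with () ← trans (sym (∧-conicalʳ _ _ p∧¬e)) (cong not ex)

  countᵇ*≤sum-map-if : (ok : A → Bool) (N : A → ℕ) (c : ℕ) → (∀ x → ok x ≡ true → c ≤ N x) →
                       (xs : List A) → countᵇ ok xs * c ≤ sum (map (λ x → if ok x then N x else 0) xs)
  countᵇ*≤sum-map-if ok N c c≤N []       = z≤n
  countᵇ*≤sum-map-if ok N c c≤N (x ∷ xs) with ok x in okx
  ... | true  = +-mono-≤ (c≤N x okx) (countᵇ*≤sum-map-if ok N c c≤N xs)
  ... | false = countᵇ*≤sum-map-if ok N c c≤N xs

sum-map-swap : {A B : Set} (F : A → B → ℕ) (xs : List A) (ys : List B) →
               sum (map (λ x → sum (map (F x) ys)) xs) ≡ sum (map (λ y → sum (map (λ x → F x y) xs)) ys)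
sum-map-swap F []       ys = sym (trans (sum-map-const 0 ys) (*-zeroʳ (length ys)))
sum-map-swap F (x ∷ xs) ys =
  trans (cong (sum (map (F x) ys) +_) (sum-map-swap F xs ys)) (sym (sum-map-+ (F x) _ ys))

module _ {B : Set} where

  ⟦any⟧ : (F : B → Bool) (ys : List B) → AllPairs (λ y y' → F y ≡ true → F y' ≡ true → ⊥) ys →
          ⟦ any F ys ⟧ ≡ sum (map (λ y → ⟦ F y ⟧) ys)
  ⟦any⟧ F []       []             = refl
  ⟦any⟧ F (y ∷ ys) (excl ∷ pairs) = trans (⟦∨⟧ excl′) (cong (⟦ F y ⟧ +_) (⟦any⟧ F ys pairs))
    where
    excl′ : F y ≡ true → any F ys ≡ true → ⊥
    excl′ Fy anyF with y′ , y′∈ys , Fy′ ← any-≡true⁻ F ys anyF = All.lookup excl y′∈ys Fy Fy′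

  countᵇ-any : {A : Set} (F : B → A → Bool) (ys : List B) (xs : List A) →
               (∀ x → AllPairs (λ y y' → F y x ≡ true → F y' x ≡ true → ⊥) ys) →
               countᵇ (λ x → any (λ y → F y x) ys) xs ≡ sum (map (λ y → countᵇ (F y) xs) ys)
  countᵇ-any F ys xs pairs = trans (cong sum (map-cong (λ x → ⟦any⟧ (λ y → F y x) ys (pairs x)) xs))
                                   (sum-map-swap (λ x y → ⟦ F y x ⟧) xs ys)

allFin-pairwise : ∀ {n} (F : Fin n → Bool) → (∀ y y′ → y ≢ y′ → F y ≡ true → F y′ ≡ true → ⊥) →
                  AllPairs (λ y y′ → F y ≡ true → F y′ ≡ true → ⊥) (allFin n)
allFin-pairwise {n} F excl = AllPairs.map (excl _ _) (allFin⁺ n)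

⌊≟⌋-refl : ∀ {n} (x : Fin n) → ⌊ x ≟ x ⌋ ≡ true
⌊≟⌋-refl x = trans (isYes≗does (x ≟ x)) (dec-true (x ≟ x) refl)

⌊≟⌋⇒≡ : ∀ {n} {x y : Fin n} → ⌊ x ≟ y ⌋ ≡ true → x ≡ y
⌊≟⌋⇒≡ x≟y = toWitness (from T-≡ x≟y)

countᵇ-≟ : ∀ {n} (x : Fin n) → countᵇ (λ v → ⌊ x ≟ v ⌋) (allFin n) ≡ 1
countᵇ-≟ {n} x = begin
  countᵇ (λ v → ⌊ x ≟ v ⌋) (allFin n)  ≡⟨ ⟦any⟧ _ (allFin n) (allFin-pairwise _ excl) ⟨
  ⟦ any (λ v → ⌊ x ≟ v ⌋) (allFin n) ⟧ ≡⟨ cong ⟦_⟧ (any-≡true⁺ _ (allFin n) (∈-allFin x) (⌊≟⌋-refl x)) ⟩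
  1                                    ∎
  where
  open ≡-Reasoning
  excl : ∀ y y′ → y ≢ y′ → ⌊ x ≟ y ⌋ ≡ true → ⌊ x ≟ y′ ⌋ ≡ true → ⊥
  excl y y′ y≢y′ x≡y x≡y′ = y≢y′ (trans (sym (⌊≟⌋⇒≡ x≡y)) (⌊≟⌋⇒≡ x≡y′))

-- Periodic sequences

Periodic : {A : Set} → ℕ → (ℕ → A) → Set
Periodic q φ = ∀ x → φ (x + q) ≡ φ x

module _ {A : Set} {q : ℕ} {φ : ℕ → A} (per : Periodic q φ) where

  periodic-+* : ∀ x c → φ (x + c * q) ≡ φ x
  periodic-+* x zero    = cong φ (+-identityʳ x)
  periodic-+* x (suc c) = begin
    φ (x + (q + c * q)) ≡⟨ cong φ (trans (cong (x +_) (+-comm q (c * q))) (sym (+-assoc x (c * q) q))) ⟩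
    φ (x + c * q + q)   ≡⟨ per (x + c * q) ⟩
    φ (x + c * q)       ≡⟨ periodic-+* x c ⟩
    φ x                 ∎
    where open ≡-Reasoning

  periodic-% : .{{_ : NonZero q}} → ∀ x → φ x ≡ φ (x % q)
  periodic-% x = trans (cong φ (m≡m%n+[m/n]*n x q)) (periodic-+* (x % q) (x / q))

  periodic-∸ : ∀ {x} → q ≤ x → φ x ≡ φ (x ∸ q)
  periodic-∸ q≤x = trans (cong φ (sym (m∸n+n≡m q≤x))) (per _)

  periodic-+ˡ : ∀ r → Periodic q (λ x → φ (r + x))
  periodic-+ˡ r x = trans (cong φ (sym (+-assoc r x q))) (per (r + x))

  periodic-+ʳ : ∀ c → Periodic q (λ x → φ (x + c))
  periodic-+ʳ c x = trans (cong φ (trans (+-assoc x q c) (trans (cong (x +_) (+-comm q c)) (sym (+-assoc x c q)))))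
                          (per (x + c))

  periodic-realign : .{{_ : NonZero q}} → ∀ r t c → φ (r + (t + r * q ∸ r + c)) ≡ φ (t + c)
  periodic-realign r t c = begin
    φ (r + (t + r * q ∸ r + c))   ≡⟨ cong φ (+-assoc r _ c) ⟨
    φ (r + (t + r * q ∸ r) + c)   ≡⟨ cong (λ z → φ (z + c)) (m+[n∸m]≡n (≤-trans (m≤m*n r q) (m≤n+m (r * q) t))) ⟩
    φ (t + r * q + c)             ≡⟨ cong φ (trans (+-assoc t (r * q) c)
                                              (trans (cong (t +_) (+-comm (r * q) c)) (sym (+-assoc t c (r * q))))) ⟩
    φ (t + c + r * q)             ≡⟨ periodic-+* (t + c) r ⟩
    φ (t + c)                     ∎
    where open ≡-Reasoning

  periodic-suc : Periodic q (φ ∘ suc)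
  periodic-suc = periodic-+ˡ 1

∑[<_] : ℕ → (ℕ → ℕ) → ℕ
∑[< q ] h = sum (applyUpTo h q)

∑-snoc : ∀ q h → ∑[< suc q ] h ≡ ∑[< q ] h + h q
∑-snoc q h = begin
  sum (applyUpTo h (suc q))      ≡⟨ cong sum (applyUpTo-∷ʳ h q) ⟨
  sum (applyUpTo h q ∷ʳ h q)     ≡⟨ sum-++ (applyUpTo h q) _ ⟩
  ∑[< q ] h + (h q + 0)          ≡⟨ cong (∑[< q ] h +_) (+-identityʳ (h q)) ⟩
  ∑[< q ] h + h q                ∎
  where open ≡-Reasoning

∑-rotate₁ : ∀ q (h : ℕ → ℕ) → h q ≡ h 0 → ∑[< q ] (h ∘ suc) ≡ ∑[< q ] h
∑-rotate₁ zero    h _      = refl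
∑-rotate₁ (suc q) h hq≡h0 = begin
  ∑[< suc q ] (h ∘ suc)         ≡⟨ ∑-snoc q (h ∘ suc) ⟩
  ∑[< q ] (h ∘ suc) + h (suc q) ≡⟨ cong (∑[< q ] (h ∘ suc) +_) hq≡h0 ⟩
  ∑[< q ] (h ∘ suc) + h 0       ≡⟨ +-comm _ (h 0) ⟩
  ∑[< suc q ] h                 ∎
  where open ≡-Reasoning

∑-rotate : ∀ q {h : ℕ → ℕ} → Periodic q h → ∀ r → ∑[< q ] (λ t → h (r + t)) ≡ ∑[< q ] h
∑-rotate q     per zero    = refl
∑-rotate q {h} per (suc r) = trans (∑-rotate q (periodic-suc per) r) (∑-rotate₁ q h (per 0))

∑-swap : {V : Set} (q : ℕ) (F : ℕ → V → ℕ) (xs : List V) →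
         ∑[< q ] (λ j → sum (map (F j) xs)) ≡ sum (map (λ x → ∑[< q ] (λ j → F j x)) xs)
∑-swap q F xs = begin
  sum (applyUpTo (λ j → sum (map (F j) xs)) q)       ≡⟨ cong sum (map-upTo _ q) ⟨
  sum (map (λ j → sum (map (F j) xs)) (upTo q))      ≡⟨ sum-map-swap (λ j x → F j x) (upTo q) xs ⟩
  sum (map (λ x → sum (map (λ j → F j x) (upTo q))) xs)
    ≡⟨ cong sum (map-cong (λ x → cong sum (map-upTo (λ j → F j x) q)) xs) ⟩
  sum (map (λ x → ∑[< q ] (λ j → F j x)) xs)          ∎
  where open ≡-Reasoning

∑-≥-const : ∀ q {h : ℕ → ℕ} {c : ℕ} → (∀ t → c ≤ h t) → q * c ≤ ∑[< q ] h
∑-≥-const zero    c≤h = z≤n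
∑-≥-const (suc q) c≤h = +-mono-≤ (c≤h 0) (∑-≥-const q (c≤h ∘ suc))

∑-const-tight : ∀ q {h : ℕ → ℕ} {c : ℕ} → (∀ t → c ≤ h t) → ∑[< q ] h ≤ q * c → ∀ t → t < q → h t ≡ c
∑-const-tight q {h} {c} c≤h ∑≤ t t<q =
  sym (All.lookup (sum-map-equality (λ t → c≤h t) (upTo q) ∑h≤∑c) (∈-upTo⁺ t<q))
  where
  ∑h≤∑c : sum (map h (upTo q)) ≤ sum (map (λ _ → c) (upTo q))
  ∑h≤∑c = begin
    sum (map h (upTo q))           ≡⟨ cong sum (map-upTo h q) ⟩
    ∑[< q ] h                      ≤⟨ ∑≤ ⟩
    q * c                          ≡⟨ cong (_* c) (length-upTo q) ⟨
    _                              ≡⟨ sum-map-const c (upTo q) ⟨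
    sum (map (λ _ → c) (upTo q))   ∎
    where open ≤-Reasoning

-- Subsets of ℤ/qℤ are q-periodic Boolean sequences, described here from a base position r.
SupportedIn : ℕ → (ℕ → Bool) → ℕ → ℕ → Set
SupportedIn q h r ℓ = ∀ y → y < q → h (r + y) ≡ true → y < ℓ

Arc : ℕ → (ℕ → Bool) → ℕ → ℕ → Set
Arc q h r ℓ = ∀ y → y < q → (h (r + y) ≡ true ⇔ y < ℓ)

Point : ℕ → (ℕ → Bool) → ℕ → ℕ → Set
Point q h r s = ∀ y → y < q → (h (r + y) ≡ true ⇔ y ≡ s)

supported-suc : ∀ {q h ℓ} → SupportedIn (suc q) h 0 (suc ℓ) → SupportedIn q (h ∘ suc) 0 ℓ
supported-suc supp y y<q hy = ≤-pred (supp (suc y) (s<s y<q) hy)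

∑-⟦⟧-≤ : ∀ q ℓ (h : ℕ → Bool) → SupportedIn q h 0 ℓ → ∑[< q ] (⟦_⟧ ∘ h) ≤ ℓ
∑-⟦⟧-≤ zero    ℓ       h supp = z≤n
∑-⟦⟧-≤ (suc q) ℓ       h supp with h 0 in h0
∑-⟦⟧-≤ (suc q) zero    h supp | true  = ⊥-elim (n≮0 (supp 0 z<s h0))
∑-⟦⟧-≤ (suc q) (suc ℓ) h supp | true  = s≤s (∑-⟦⟧-≤ q ℓ (h ∘ suc) (supported-suc supp))
∑-⟦⟧-≤ (suc q) ℓ       h supp | false =
  ∑-⟦⟧-≤ q ℓ (h ∘ suc) (λ y y<q hy → <-trans (n<1+n y) (supp (suc y) (s<s y<q) hy))

∑-⟦⟧-covered : ∀ q ℓ (h : ℕ → Bool) → SupportedIn q h 0 ℓ → ∑[< q ] (⟦_⟧ ∘ h) ≡ ℓ →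
               ∀ y → y < ℓ → h y ≡ true
∑-⟦⟧-covered zero    (suc ℓ) h supp ()  y y<ℓ
∑-⟦⟧-covered (suc q) (suc ℓ) h supp ∑≡ y y<ℓ with h 0 in h0 | y
... | true  | zero  = h0
... | true  | suc y = ∑-⟦⟧-covered q ℓ (h ∘ suc) (supported-suc supp) (suc-injective ∑≡) y (≤-pred y<ℓ)
... | false | _     = ⊥-elim (<-irrefl ∑≡ (s≤s (∑-⟦⟧-≤ q ℓ (h ∘ suc) (supported-suc supp))))

module _ {q : ℕ} {h : ℕ → Bool} (per : Periodic q h) {r ℓ : ℕ} (supp : SupportedIn q h r ℓ) where

  supported-∑-≤ : ∑[< q ] (⟦_⟧ ∘ h) ≤ ℓ
  supported-∑-≤ = subst (_≤ ℓ) (∑-rotate q (cong ⟦_⟧ ∘ per) r) (∑-⟦⟧-≤ q ℓ (λ y → h (r + y)) supp)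

  supported-∑-arc : ∑[< q ] (⟦_⟧ ∘ h) ≡ ℓ → Arc q h r ℓ
  supported-∑-arc ∑≡ y y<q = mk⇔ (supp y y<q) (∑-⟦⟧-covered q ℓ (λ y → h (r + y)) supp ∑≡′ y)
    where ∑≡′ = trans (∑-rotate q (cong ⟦_⟧ ∘ per) r) ∑≡

least : {P : ℕ → Set} → Decidable P → ∀ {N} → P N → ∃ λ i → i ≤ N × P i × (∀ j → j < i → ¬ P j)
least {P} P? {N} pN with first N
  where
  first : ∀ N → (∃ λ i → i < N × P i × (∀ j → j < i → ¬ P j)) ⊎ (∀ i → i < N → ¬ P i)
  first zero = inj₂ (λ i ())
  first (suc N) with first N | P? N
  ... | inj₁ (i , i<N , pi , below) | _     = inj₁ (i , m<n⇒m<1+n i<N , pi , below)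
  ... | inj₂ none                   | yes p = inj₁ (N , n<1+n N , p , none)
  ... | inj₂ none                   | no ¬p = inj₂ λ i i<1+N → [ none i , (λ { refl → ¬p }) ]′ (m<1+n⇒m<n∨m≡n i<1+N)
... | inj₁ (i , i<N , pi , below) = i , <⇒≤ i<N , pi , below
... | inj₂ none                   = N , ≤-refl , pN , none

reindex-earlier : ∀ x {q t₀ s t} → s ≤ t₀ → s + t ≡ q → x + (t₀ ∸ s) + q ≡ x + t₀ + t
reindex-earlier x {q} {t₀} {s} {t} s≤t₀ s+t≡q = begin
  x + (t₀ ∸ s) + q        ≡⟨ cong (x + (t₀ ∸ s) +_) s+t≡q ⟨
  x + (t₀ ∸ s) + (s + t)  ≡⟨ reassoc x (t₀ ∸ s) s t ⟩
  x + (t₀ ∸ s + s) + t    ≡⟨ cong (λ z → x + z + t) (m∸n+n≡m s≤t₀) ⟩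
  x + t₀ + t              ∎
  where
  open ≡-Reasoning
  reassoc : ∀ a b c d → a + b + (c + d) ≡ a + (b + c) + d
  reassoc = solve-∀

reindex-before : ∀ j {q K t₀ u t} → K ≤ q → K + u ≤ q → t₀ + u + t ≡ q →
                 j + (q ∸ (K + u)) + q ≡ j + (q ∸ K) + t₀ + t
reindex-before j {q} {K} {t₀} {u} {t} K≤q K+u≤q t₀+u+t≡q = +-cancelʳ-≡ (K + u) _ _ (begin
  j + (q ∸ (K + u)) + q + (K + u)     ≡⟨ reassoc₁ j (q ∸ (K + u)) q (K + u) ⟩
  j + q + (q ∸ (K + u) + (K + u))     ≡⟨ cong (j + q +_) (m∸n+n≡m K+u≤q) ⟩
  j + q + q                           ≡⟨ cong₂ (λ a b → j + a + b) (m∸n+n≡m K≤q) t₀+u+t≡q ⟨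
  j + (q ∸ K + K) + (t₀ + u + t)      ≡⟨ reassoc₂ j (q ∸ K) K t₀ u t ⟩
  j + (q ∸ K) + t₀ + t + (K + u)      ∎)
  where
  open ≡-Reasoning
  reassoc₁ : ∀ a b c d → a + b + c + d ≡ a + c + (b + d)
  reassoc₁ = solve-∀
  reassoc₂ : ∀ a b c d e g → a + (b + c) + (d + e + g) ≡ a + b + d + g + (c + e)
  reassoc₂ = solve-∀

ShortChords : ℕ → (ℕ → Bool) → ℕ → Set
ShortChords q f K = ∀ x d → d < q → f x ≡ true → f (x + d) ≡ true → d ≤ K ⊎ q ∸ d ≤ K

module _ {q K : ℕ} {f : ℕ → Bool} (per : Periodic q f) (chords : ShortChords q f K)
         (3K<q : K + K + K < q) where

  private
    K≤q : K ≤ q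
    K≤q = ≤-trans (≤-trans (m≤m+n K K) (m≤m+n (K + K) K)) (<⇒≤ 3K<q)

    shift-back : ∀ {x y} → x + q ≡ y → f y ≡ true → f x ≡ true
    shift-back x+q≡y fy = trans (sym (per _)) (trans (cong f x+q≡y) fy)

    far-cluster : ∀ {j} → f j ≡ true → ∀ D → K < D → D ≤ K + K → f (j + (q ∸ D)) ≡ true → ⊥
    far-cluster {j} fj D K<D D≤2K fjd with chords j (q ∸ D) (∸-monoʳ-< (≤-trans (s≤s z≤n) K<D) D≤q) fj fjd
      where D≤q = ≤-trans D≤2K (≤-trans (m≤m+n (K + K) K) (<⇒≤ 3K<q))
    ... | inj₁ q∸D≤K = <⇒≱ 3K<q (begin
      q                  ≤⟨ m≤n+m∸n q D ⟩
      D + (q ∸ D)        ≤⟨ +-mono-≤ D≤2K q∸D≤K ⟩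
      K + K + K          ∎)
      where open ≤-Reasoning
    ... | inj₂ D≤K = <⇒≱ K<D (≤-trans (≤-reflexive (sym (m∸[m∸n]≡n D≤q))) D≤K)
      where D≤q = ≤-trans D≤2K (≤-trans (m≤m+n (K + K) K) (<⇒≤ 3K<q))

  -- m is the first of the positions j - K, …, j (mod q) where f holds; a hit beyond m + K would
  -- either come earlier in that range or lie at cyclic distance more than K from j.
  frame : ∀ {j} → f j ≡ true → ∃ λ m → f m ≡ true × SupportedIn q f m (suc K)
  frame {j} fj with least (λ t → f (j + (q ∸ K) + t) ≟ᵇ true) fj+q
    where
    fj+q : f (j + (q ∸ K) + K) ≡ true
    fj+q = trans (cong f (trans (+-assoc j (q ∸ K) K) (cong (j +_) (m∸n+n≡m K≤q)))) (trans (per j) fj)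
  ... | t₀ , _ , fm , minimal = j + (q ∸ K) + t₀ , fm , inside
    where
    m = j + (q ∸ K) + t₀
    inside : SupportedIn q f m (suc K)
    inside t t<q fmt with chords m t t<q fm fmt | (q ∸ t) ≤? t₀
    ... | inj₁ t≤K | _        = s≤s t≤K
    ... | inj₂ _   | yes s≤t₀ =
      ⊥-elim (minimal (t₀ ∸ (q ∸ t)) (∸-monoʳ-< (m<n⇒0<n∸m t<q) s≤t₀)
                      (shift-back (reindex-earlier (j + (q ∸ K)) s≤t₀ (m∸n+n≡m (<⇒≤ t<q))) fmt))
    ... | inj₂ s≤K | no  s≰t₀ =
      ⊥-elim (far-cluster fj (K + u) K<K+u K+u≤2K (shift-back (reindex-before j K≤q K+u≤q t₀+u+t≡q) fmt))
      where
      u = q ∸ t ∸ t₀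
      t₀+u+t≡q : t₀ + u + t ≡ q
      t₀+u+t≡q = trans (cong (_+ t) (m+[n∸m]≡n (<⇒≤ (≰⇒> s≰t₀)))) (m∸n+n≡m (<⇒≤ t<q))
      K<K+u : K < K + u
      K<K+u = m<m+n K (m<n⇒0<n∸m (≰⇒> s≰t₀))
      K+u≤2K : K + u ≤ K + K
      K+u≤2K = +-monoʳ-≤ K (≤-trans (m∸n≤m (q ∸ t) t₀) s≤K)
      K+u≤q : K + u ≤ q
      K+u≤q = ≤-trans K+u≤2K (≤-trans (m≤m+n (K + K) K) (<⇒≤ 3K<q))

module _ {q k : ℕ} {f : ℕ → Bool} (per : Periodic q f) (4k<q : k + k + (k + k) < q) where

  private
    k<q : k < q
    k<q = ≤-<-trans (≤-trans (m≤m+n k k) (m≤m+n (k + k) (k + k))) 4k<q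

    back : ∀ m y → f (m + y + q ∸ k) ≡ f (m + (y + q ∸ k))
    back m y = cong f (trans (cong (_∸ k) (+-assoc m y q)) (+-∸-assoc m (≤-trans (<⇒≤ k<q) (m≤n+m q y))))

  midpoint-unique : ∀ {m} → SupportedIn q f m (suc (k + k)) → ∀ {y} → y < q →
                    f (m + y + q ∸ k) ≡ true → f (m + y + k) ≡ true → y ≡ k
  midpoint-unique {m} supp {y} y<q before after with k ≤? y
  ... | yes k≤y = ≤-antisym (+-cancelʳ-≤ k y k (≤-pred y+k<2k+1)) k≤y
    where
    y∸k≤2k : y ∸ k ≤ k + k
    y∸k≤2k = ≤-pred (supp (y ∸ k) (≤-<-trans (m∸n≤m y k) y<q)
               (trans (sym (per _)) (trans (cong f (+-assoc m (y ∸ k) q))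
                 (trans (cong (λ z → f (m + z)) (sym (+-∸-comm q k≤y))) (trans (sym (back m y)) before)))))
    y+k<q : y + k < q
    y+k<q = ≤-<-trans (begin
      y + k              ≡⟨ cong (_+ k) (m∸n+n≡m k≤y) ⟨
      y ∸ k + k + k      ≤⟨ +-monoˡ-≤ k (+-monoˡ-≤ k y∸k≤2k) ⟩
      k + k + k + k      ≡⟨ +-assoc (k + k) k k ⟩
      k + k + (k + k)    ∎) 4k<q
      where open ≤-Reasoning
    y+k<2k+1 : y + k < suc (k + k)
    y+k<2k+1 = supp (y + k) y+k<q (trans (cong f (sym (+-assoc m y k))) after)
  ... | no  k≰y = ⊥-elim (<⇒≱ 4k<q (begin
      q                  ≤⟨ m≤m+n q y ⟩
      q + y              ≡⟨ +-comm q y ⟩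
      y + q              ≡⟨ m∸n+n≡m (≤-trans (<⇒≤ k<q) (m≤n+m q y)) ⟨
      y + q ∸ k + k      ≤⟨ +-monoˡ-≤ k (≤-pred (supp _ y+q∸k<q (trans (sym (back m y)) before))) ⟩
      k + k + k          ≤⟨ +-monoʳ-≤ (k + k) (m≤m+n k k) ⟩
      k + k + (k + k)    ∎))
    where
    open ≤-Reasoning
    y+q∸k<q : y + q ∸ k < q
    y+q∸k<q = subst (y + q ∸ k <_) (m+n∸m≡n k q)
                (∸-monoˡ-< (+-monoˡ-< q (≰⇒> k≰y)) (≤-trans (<⇒≤ k<q) (m≤n+m q y)))

  midpoint : ∀ {m} → SupportedIn q f m (suc (k + k)) → f m ≡ true → f (m + (k + k)) ≡ true →
             Point q (λ c → f (c + q ∸ k) ∧ f (c + k)) m k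
  midpoint {m} supp fm fm+2k y y<q =
    mk⇔ (λ both → midpoint-unique supp y<q (∧-conicalˡ _ _ both) (∧-conicalʳ _ _ both)) at-k
    where
    at-k : y ≡ k → (f (m + y + q ∸ k) ∧ f (m + y + k)) ≡ true
    at-k refl = cong₂ _∧_ (trans (back m k) (trans (cong (λ z → f (m + z)) (m+n∸m≡n k q)) (trans (per m) fm)))
                          (trans (cong f (+-assoc m k k)) fm+2k)

module _ {q g s a : ℕ} {E L : ℕ → Bool} (perE : Periodic q E) (perL : Periodic q L)
         (g≡s+1+a : g ≡ s + suc a) (s+g<q : s + g < q) where

  private
    g<q : g < q
    g<q = ≤-<-trans (m≤n+m g s) s+g<q
    s<g : s < g
    s<g = subst (s <_) (sym g≡s+1+a) (m<m+n s z<s)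
    a<g : a < g
    a<g = subst (a <_) (sym g≡s+1+a) (≤-trans (n<1+n a) (m≤n+m (suc a) s))
    ≢true : ∀ {b} → (b ≡ true → ⊥) → b ≡ false
    ≢true = ¬-not

  module _ (arc : Arc q E 0 g) (point : Point q L 0 s) where

    private
      E-in : ∀ {y} → y < g → E y ≡ true
      E-in {y} y<g = from (arc y (<-trans y<g g<q)) y<g
      E-out : ∀ {y} → g ≤ y → y < q → E y ≡ false
      E-out g≤y y<q = ≢true (λ Ey → <⇒≱ (to (arc _ y<q) Ey) g≤y)
      E-step : ∀ x → suc x ≢ g → suc x ≢ q → suc x < q + g → E (suc x) ≡ E x
      E-step x x+1≢g x+1≢q x+1<q+g with <-cmp (suc x) q | <-cmp (suc x) g
      ... | tri< x+1<q _ _ | tri< x+1<g _ _ = trans (E-in x+1<g) (sym (E-in (<-trans (n<1+n x) x+1<g)))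
      ... | tri< x+1<q _ _ | tri> _ _ g<x+1 = trans (E-out (<⇒≤ g<x+1) x+1<q) (sym (E-out (≤-pred g<x+1) (<-trans (n<1+n x) x+1<q)))
      ... | tri< _ _ _     | tri≈ _ x+1≡g _ = ⊥-elim (x+1≢g x+1≡g)
      ... | tri≈ _ x+1≡q _ | _              = ⊥-elim (x+1≢q x+1≡q)
      ... | tri> _ _ q<x+1 | _              = begin
        E (suc x)         ≡⟨ periodic-∸ perE (<⇒≤ q<x+1) ⟩
        E (suc x ∸ q)     ≡⟨ E-in wrapped<g ⟩
        true              ≡⟨ E-in (≤-<-trans (∸-monoˡ-≤ q (n≤1+n x)) wrapped<g) ⟨
        E (x ∸ q)         ≡⟨ periodic-∸ perE (≤-pred q<x+1) ⟨
        E x               ∎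
        where
        open ≡-Reasoning
        wrapped<g : suc x ∸ q < g
        wrapped<g = +-cancelˡ-< q _ _ (subst (_< q + g) (sym (m+[n∸m]≡n (<⇒≤ q<x+1))) x+1<q+g)
      L-at : L s ≡ true
      L-at = from (point s (<-trans s<g g<q)) refl
      L-off : ∀ {y} → y < q → y ≢ s → L y ≡ false
      L-off y<q y≢s = ≢true (λ Ly → y≢s (to (point _ y<q) Ly))
      L-off₂ : ∀ {y} → y < q + q → y ≢ s → y ≢ q + s → L y ≡ false
      L-off₂ {y} y<2q y≢s y≢q+s with y <? q
      ... | yes y<q = L-off y<q y≢s
      ... | no  y≮q = trans (periodic-∸ perL q≤y) (L-off (+-cancelˡ-< q _ _ (subst (_< q + q) (sym y≡) y<2q))
                                                         (λ y∸q≡s → y≢q+s (trans (sym y≡) (cong (q +_) y∸q≡s))))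
        where
        q≤y = ≮⇒≥ y≮q
        y≡ : q + (y ∸ q) ≡ y
        y≡ = m+[n∸m]≡n q≤y

      crossed : ∀ {w x y z} → w ≡ z → x ≡ y → ⟦ w ⟧ + ⟦ x ⟧ ≡ ⟦ y ⟧ + ⟦ z ⟧
      crossed {w} {x} refl refl = +-comm ⟦ w ⟧ ⟦ x ⟧

      t+g≡ : ∀ t → t + g ≡ s + suc (t + a)
      t+g≡ t = trans (cong (t +_) g≡s+1+a) (reassoc t s a)
        where
        reassoc : ∀ t s a → t + (s + suc a) ≡ s + suc (t + a)
        reassoc = solve-∀

      at-point : ⟦ E (s + a) ⟧ + ⟦ L (s + g) ⟧ ≡ ⟦ E (s + suc a) ⟧ + ⟦ L s ⟧
      at-point = crossed (trans (E-in s+a<g) (sym L-at))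
                         (trans (L-off s+g<q s+g≢s) (sym (trans (cong E (sym g≡s+1+a)) (E-out ≤-refl g<q))))
        where
        s+a<g : s + a < g
        s+a<g = subst (s + a <_) (sym g≡s+1+a) (+-monoʳ-< s (n<1+n a))
        s+g≢s : s + g ≢ s
        s+g≢s s+g≡s = <⇒≢ (m<m+n s (≤-<-trans z≤n s<g)) (sym s+g≡s)

      at-wrap : ∀ {t} → t < q → t ≢ s → suc (t + a) ≡ q → ⟦ E (t + a) ⟧ + ⟦ L (t + g) ⟧ ≡ ⟦ E (t + suc a) ⟧ + ⟦ L t ⟧
      at-wrap {t} t<q t≢s t+a+1≡q = crossed (trans (E-out g≤t+a t+a<q) (sym (L-off t<q t≢s))) (trans L-wraps (sym E-wraps))
        where
        t+a<q : t + a < q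
        t+a<q = subst (t + a <_) t+a+1≡q (n<1+n (t + a))
        g≤t+a : g ≤ t + a
        g≤t+a = ≤-pred (subst (g <_) (sym t+a+1≡q) g<q)
        L-wraps : L (t + g) ≡ true
        L-wraps = trans (cong L (trans (t+g≡ t) (cong (s +_) t+a+1≡q))) (trans (perL s) L-at)
        E-wraps : E (t + suc a) ≡ true
        E-wraps = trans (cong E (trans (+-suc t a) t+a+1≡q)) (trans (perE 0) (E-in (≤-<-trans z≤n s<g)))

      elsewhere : ∀ {t} → t < q → t ≢ s → suc (t + a) ≢ q → ⟦ E (t + a) ⟧ + ⟦ L (t + g) ⟧ ≡ ⟦ E (t + suc a) ⟧ + ⟦ L t ⟧
      elsewhere {t} t<q t≢s t+a+1≢q = cong₂ (λ b c → ⟦ b ⟧ + ⟦ c ⟧) E-same (trans L-off-shifted (sym (L-off t<q t≢s)))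
        where
        E-same : E (t + a) ≡ E (t + suc a)
        E-same = sym (trans (cong E (+-suc t a)) (E-step (t + a) t+a+1≢g t+a+1≢q (+-mono-≤-< t<q a<g)))
          where
          t+a+1≢g : suc (t + a) ≢ g
          t+a+1≢g eq = t≢s (+-cancelʳ-≡ (suc a) t s (trans (+-suc t a) (trans eq g≡s+1+a)))
        L-off-shifted : L (t + g) ≡ false
        L-off-shifted = L-off₂ (+-mono-< t<q g<q) t+g≢s t+g≢q+s
          where
          t+g≢s : t + g ≢ s
          t+g≢s eq = <⇒≢ (<-≤-trans s<g (m≤n+m g t)) (sym eq)
          t+g≢q+s : t + g ≢ q + s
          t+g≢q+s eq = t+a+1≢q (+-cancelˡ-≡ s _ _ (trans (sym (t+g≡ t)) (trans eq (+-comm q s))))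

    arc-point-balance₀ : ∀ t → t < q → ⟦ E (t + a) ⟧ + ⟦ L (t + g) ⟧ ≡ ⟦ E (t + suc a) ⟧ + ⟦ L t ⟧
    arc-point-balance₀ t t<q with t ≟ℕ s | suc (t + a) ≟ℕ q
    ... | yes refl | _           = at-point
    ... | no  t≢s  | yes t+a+1≡q = at-wrap t<q t≢s t+a+1≡q
    ... | no  t≢s  | no  t+a+1≢q = elsewhere t<q t≢s t+a+1≢q

-- Moving from E (t + a) to E (t + suc a), a point leaves the arc exactly when t is the point
-- of L, and enters it exactly when t + g is.
arc-point-balance : ∀ {q g s a : ℕ} {E L : ℕ → Bool} → Periodic q E → Periodic q L →
          g ≡ s + suc a → s + g < q → ∀ {r} → Arc q E r g → Point q L r s →
          ∀ t → ⟦ E (t + a) ⟧ + ⟦ L (t + g) ⟧ ≡ ⟦ E (t + suc a) ⟧ + ⟦ L t ⟧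
arc-point-balance {q} {g} {s} {a} {E} {L} perE perL g≡s+1+a s+g<q {r} arc point t = begin
  ⟦ E (t + a) ⟧ + ⟦ L (t + g) ⟧           ≡⟨ cong₂ _+_ (realign perE a) (realign perL g) ⟨
  Φ′ t′                                    ≡⟨ periodic-% perΦ′ t′ ⟩
  Φ′ (t′ % q)                              ≡⟨ arc-point-balance₀ perE′ perL′ g≡s+1+a s+g<q arc point (t′ % q) (m%n<n t′ q) ⟩
  Ψ′ (t′ % q)                              ≡⟨ periodic-% perΨ′ t′ ⟨
  Ψ′ t′                                    ≡⟨ cong₂ _+_ (realign perE (suc a)) realign₀ ⟩
  ⟦ E (t + suc a) ⟧ + ⟦ L t ⟧              ∎
  where
  open ≡-Reasoning
  instance
    _ : NonZero q
    _ = >-nonZero (≤-<-trans z≤n s+g<q)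
  E′ L′ : ℕ → Bool
  E′ y = E (r + y)
  L′ y = L (r + y)
  perE′ = periodic-+ˡ perE r
  perL′ = periodic-+ˡ perL r
  Φ′ Ψ′ : ℕ → ℕ
  Φ′ x = ⟦ E′ (x + a) ⟧ + ⟦ L′ (x + g) ⟧
  Ψ′ x = ⟦ E′ (x + suc a) ⟧ + ⟦ L′ x ⟧
  perΦ′ : Periodic q Φ′
  perΦ′ x = cong₂ _+_ (cong ⟦_⟧ (periodic-+ʳ perE′ a x)) (cong ⟦_⟧ (periodic-+ʳ perL′ g x))
  perΨ′ : Periodic q Ψ′
  perΨ′ x = cong₂ _+_ (cong ⟦_⟧ (periodic-+ʳ perE′ (suc a) x)) (cong ⟦_⟧ (perL′ x))
  t′ = t + r * q ∸ r
  realign : ∀ {φ : ℕ → Bool} → Periodic q φ → ∀ c → ⟦ φ (r + (t′ + c)) ⟧ ≡ ⟦ φ (t + c) ⟧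
  realign per c = cong ⟦_⟧ (periodic-realign per r t c)
  realign₀ : ⟦ L (r + t′) ⟧ ≡ ⟦ L t ⟧
  realign₀ = begin
    ⟦ L (r + t′) ⟧       ≡⟨ cong (λ z → ⟦ L (r + z) ⟧) (+-identityʳ t′) ⟨
    ⟦ L (r + (t′ + 0)) ⟧ ≡⟨ realign perL 0 ⟩
    ⟦ L (t + 0) ⟧        ≡⟨ cong (λ z → ⟦ L z ⟧) (+-identityʳ t) ⟩
    ⟦ L t ⟧              ∎

module _ {V : Set} (vs : List V) {q g s a M : ℕ} (E L : ℕ → V → Bool)
         (perE : ∀ v → Periodic q (λ j → E j v)) (perL : ∀ v → Periodic q (λ j → L j v))
         (g≡s+1+a : g ≡ s + suc a) (s+g<q : s + g < q)
         (E-large : ∀ j → M ≤ countᵇ (E j) vs) (total : length vs * g ≡ q * M)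
         (hits≤ : ∀ v → ∑[< q ] (λ j → ⟦ E j v ⟧) ≤ g)
         (profile : ∀ v → ∑[< q ] (λ j → ⟦ E j v ⟧) ≡ g →
                    ∃ λ r → Arc q (λ j → E j v) r g × Point q (λ j → L j v) r s) where

  private
    instance
      _ : NonZero q
      _ = >-nonZero (≤-<-trans z≤n s+g<q)

    hits : V → ℕ
    hits v = ∑[< q ] (λ j → ⟦ E j v ⟧)

    ∑count≡∑hits : ∑[< q ] (λ j → countᵇ (E j) vs) ≡ sum (map hits vs)
    ∑count≡∑hits = ∑-swap q (λ j v → ⟦ E j v ⟧) vs

    ∑hits≤ : sum (map hits vs) ≤ q * M
    ∑hits≤ = ≤-trans (sum-map-≤-const hits≤ vs) (≤-reflexive total)

    count-E : ∀ j → countᵇ (E j) vs ≡ M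
    count-E j = trans (periodic-% perA j)
                      (∑-const-tight q E-large (≤-trans (≤-reflexive ∑count≡∑hits) ∑hits≤) (j % q) (m%n<n j q))
      where
      perA : Periodic q (λ j → countᵇ (E j) vs)
      perA j = cong sum (map-cong (λ v → cong ⟦_⟧ (perE v j)) vs)

    all-hits : All (λ v → hits v ≡ g) vs
    all-hits = sum-map-equality hits≤ vs (begin
      sum (map (λ _ → g) vs)                 ≡⟨ sum-map-const g vs ⟩
      length vs * g                          ≡⟨ total ⟩
      q * M                                  ≤⟨ ∑-≥-const q E-large ⟩
      ∑[< q ] (λ j → countᵇ (E j) vs)        ≡⟨ ∑count≡∑hits ⟩
      sum (map hits vs)                      ∎)
      where open ≤-Reasoning

  count-shift-invariant : ∀ c → countᵇ (L c) vs ≡ countᵇ (L (c + g)) vs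
  count-shift-invariant c = +-cancelˡ-≡ M _ _ (begin
    M + countᵇ (L c) vs                                         ≡⟨ cong (_+ countᵇ (L c) vs) (count-E (c + suc a)) ⟨
    countᵇ (E (c + suc a)) vs + countᵇ (L c) vs                 ≡⟨ sum-map-+ _ _ vs ⟨
    sum (map (λ v → ⟦ E (c + suc a) v ⟧ + ⟦ L c v ⟧) vs)        ≡⟨ cong sum (map-cong-local (All.map pointwise all-hits)) ⟨
    sum (map (λ v → ⟦ E (c + a) v ⟧ + ⟦ L (c + g) v ⟧) vs)      ≡⟨ sum-map-+ _ _ vs ⟩
    countᵇ (E (c + a)) vs + countᵇ (L (c + g)) vs               ≡⟨ cong (_+ countᵇ (L (c + g)) vs) (count-E (c + a)) ⟩
    M + countᵇ (L (c + g)) vs                                   ∎)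
    where
    open ≡-Reasoning
    pointwise : ∀ {v} → hits v ≡ g → ⟦ E (c + a) v ⟧ + ⟦ L (c + g) v ⟧ ≡ ⟦ E (c + suc a) v ⟧ + ⟦ L c v ⟧
    pointwise {v} hits≡g with r , arc , point ← profile v hits≡g =
      arc-point-balance (perE v) (perL v) g≡s+1+a s+g<q arc point c

-- The window sequence E built from f: f itself for odd girth, j ↦ f (j - 1) ∨ f j for even girth.
record Widening (q K : ℕ) (f E : ℕ → Bool) (g : ℕ) : Set where
  field
    periodic  : Periodic q E
    nonempty  : ∀ {j} → E j ≡ true → ∃ λ j′ → f j′ ≡ true
    supported : ∀ {m} → SupportedIn q f m (suc K) → SupportedIn q E m g
    reaches   : ∀ {m} → SupportedIn q f m (suc K) → Arc q E m g → f (m + K) ≡ true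

module _ {q k : ℕ} {f : ℕ → Bool} (per : Periodic q f) (chords : ShortChords q f (k + k))
         (6k<q : k + k + (k + k) + (k + k) < q) where

  vertex-profile : ∀ {E g} → 0 < g → Widening q (k + k) f E g →
                   ∑[< q ] (⟦_⟧ ∘ E) ≤ g ×
                   (∑[< q ] (⟦_⟧ ∘ E) ≡ g → ∃ λ r → Arc q E r g × Point q (λ c → f (c + q ∸ k) ∧ f (c + k)) r k)
  vertex-profile {E} {g} 0<g wide with anyUpTo? (λ j → E j ≟ᵇ true) q
  ... | no none = ≤-trans ∑≤0 z≤n , λ ∑≡g → ⊥-elim (<⇒≱ 0<g (≤-trans (≤-reflexive (sym ∑≡g)) ∑≤0))
    where
    ∑≤0 : ∑[< q ] (⟦_⟧ ∘ E) ≤ 0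
    ∑≤0 = ∑-⟦⟧-≤ q 0 E (λ y y<q Ey → ⊥-elim (none (y , y<q , Ey)))
  ... | yes (j , _ , Ej) with j′ , fj′ ← Widening.nonempty wide Ej with m , fm , supp ← frame per chords 6k<q fj′ =
    supported-∑-≤ periodic (supported supp) ,
    λ ∑≡g → let arc = supported-∑-arc periodic (supported supp) ∑≡g in
            m , arc , midpoint per 4k<q supp fm (reaches supp arc)
    where
    open Widening wide using (periodic; supported; reaches)
    4k<q : k + k + (k + k) < q
    4k<q = ≤-<-trans (m≤m+n _ (k + k)) 6k<q

module _ {q K : ℕ} {f : ℕ → Bool} (per : Periodic q f) (K<q : K < q) where

  identity-widening : Widening q K f f (suc K)
  identity-widening = record
    { periodic  = per
    ; nonempty  = λ {j} fj → j , fj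
    ; supported = λ supp → supp
    ; reaches   = λ _ arc → from (arc K K<q) (n<1+n K)
    }

  private
    1+[q∸1]≡q : suc (q ∸ 1) ≡ q
    1+[q∸1]≡q = trans (+-comm 1 (q ∸ 1)) (m∸n+n≡m (≤-trans (s≤s z≤n) K<q))

    back-step : ∀ x → suc x + (q ∸ 1) ≡ x + q
    back-step x = trans (sym (+-suc x (q ∸ 1))) (cong (x +_) 1+[q∸1]≡q)

    ∨-false : ∀ {b c} → c ≡ false → b ∨ c ≡ true → b ≡ true
    ∨-false {b} refl b∨false = trans (sym (∨-identityʳ b)) b∨false

  edge-widening : suc K < q → Widening q K f (λ j → f (j + (q ∸ 1)) ∨ f j) (suc (suc K))
  edge-widening K+1<q = record
    { periodic  = λ x → cong₂ _∨_ (periodic-+ʳ per (q ∸ 1) x) (per x)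
    ; nonempty  = nonempty
    ; supported = supported
    ; reaches   = reaches
    }
    where
    nonempty : ∀ {j} → f (j + (q ∸ 1)) ∨ f j ≡ true → ∃ λ j′ → f j′ ≡ true
    nonempty {j} Ej with f j in fj
    ... | true  = j , fj
    ... | false = j + (q ∸ 1) , ∨-false refl Ej
    supported : ∀ {m} → SupportedIn q f m (suc K) → SupportedIn q (λ j → f (j + (q ∸ 1)) ∨ f j) m (suc (suc K))
    supported {m} supp y y<q Ey with f (m + y) in fmy
    ... | true  = m<n⇒m<1+n (supp y y<q fmy)
    supported {m} supp zero    y<q Ey | false =
      ⊥-elim (<⇒≱ K+1<q (subst (_≤ suc K) 1+[q∸1]≡q
                                (supp (q ∸ 1) (∸-monoʳ-< z<s (≤-trans (s≤s z≤n) K<q))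
                                      (trans (cong (λ z → f (z + (q ∸ 1))) (sym (+-identityʳ m))) (∨-false refl Ey)))))
    supported {m} supp (suc y) y<q Ey | false =
      s≤s (supp y (<-trans (n<1+n y) y<q)
                 (trans (sym (per (m + y))) (trans (cong f (sym (trans (cong (_+ (q ∸ 1)) (+-suc m y)) (back-step (m + y)))))
                                                   (∨-false refl Ey))))
    reaches : ∀ {m} → SupportedIn q f m (suc K) → Arc q (λ j → f (j + (q ∸ 1)) ∨ f j) m (suc (suc K)) → f (m + K) ≡ true
    reaches {m} supp arc = trans (sym (per (m + K)))
      (trans (cong f (sym (trans (cong (_+ (q ∸ 1)) (+-suc m K)) (back-step (m + K)))))
             (∨-false fm+K+1 (from (arc (suc K) K+1<q) (n<1+n (suc K)))))
      where
      fm+K+1 : f (m + suc K) ≡ false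
      fm+K+1 = ¬-not (λ fm+K+1 → <-irrefl refl (supp (suc K) K+1<q fm+K+1))

-- Balls

module _ (Γ : Graph) where
  open Graph Γ renaming (sym to adj-sym)

  within-zero⁻ : ∀ {u v} → within Γ 0 u v ≡ true → u ≡ v
  within-zero⁻ = ⌊≟⌋⇒≡

  within-suc : ∀ i {u v} → within Γ i u v ≡ true → within Γ (suc i) u v ≡ true
  within-suc i u~v rewrite u~v = refl

  within-mono : ∀ {i j u v} → i ≤ j → within Γ i u v ≡ true → within Γ j u v ≡ true
  within-mono {j = zero}  z≤n  u~v = u~v
  within-mono {i} {suc j} i≤1+j u~v with m≤n⇒m<n∨m≡n i≤1+j
  ... | inj₁ i<1+j = within-suc j (within-mono (≤-pred i<1+j) u~v)
  ... | inj₂ refl  = u~v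

  within-refl : ∀ i u → within Γ i u u ≡ true
  within-refl i u = within-mono {j = i} z≤n (⌊≟⌋-refl u)

  within-step : ∀ i {u w v} → within Γ i u w ≡ true → adj w v ≡ true → within Γ (suc i) u v ≡ true
  within-step i {u} {w} {v} u~w w~v =
    trans (cong (within Γ i u v ∨_) (any-≡true⁺ _ (allFin n) (∈-allFin w) (cong₂ _∧_ u~w w~v))) (∨-zeroʳ _)

  within-suc⁻ : ∀ i {u v} → within Γ (suc i) u v ≡ true →
                within Γ i u v ≡ true ⊎ ∃ λ w → within Γ i u w ≡ true × adj w v ≡ true
  within-suc⁻ i {u} {v} u~v with within Γ i u v
  ... | true  = inj₁ refl
  ... | false with w , _ , u~w∧w~v ← any-≡true⁻ _ (allFin n) u~v =
    inj₂ (w , ∧-conicalˡ _ _ u~w∧w~v , ∧-conicalʳ _ _ u~w∧w~v)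

  within-trans : ∀ a b {u x y} → within Γ a u x ≡ true → within Γ b x y ≡ true → within Γ (a + b) u y ≡ true
  within-trans a zero    u~x x~y rewrite within-zero⁻ x~y | +-identityʳ a = u~x
  within-trans a (suc b) u~x x~y rewrite +-suc a b with within-suc⁻ b x~y
  ... | inj₁ x~y′           = within-suc (a + b) (within-trans a b u~x x~y′)
  ... | inj₂ (w , x~w , w~y) = within-step (a + b) (within-trans a b u~x x~w) w~y

  within-sym : ∀ i {u v} → within Γ i u v ≡ true → within Γ i v u ≡ true
  within-sym zero    u~v rewrite within-zero⁻ u~v = ⌊≟⌋-refl _
  within-sym (suc i) u~v with within-suc⁻ i u~v
  ... | inj₁ u~v′            = within-suc i (within-sym i u~v′)
  ... | inj₂ (w , u~w , w~v) = within-trans 1 i (within-step 0 (⌊≟⌋-refl _) (trans (adj-sym _ _) w~v)) (within-sym i u~w)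

  Dist⇒≤ : ∀ {u v m t} → Dist Γ u v m → within Γ t u v ≡ true → m ≤ t
  Dist⇒≤ {m = zero}          _            _   = z≤n
  Dist⇒≤ {m = suc m} {t} (_ , ¬u~v) u~v with suc m ≤? t
  ... | yes m<t = m<t
  ... | no  m≮t with () ← trans (sym (within-mono (≤-pred (≰⇒> m≮t)) u~v)) ¬u~v

⊓-≤⁻ : ∀ {a b c} → a ⊓ b ≤ c → a ≤ c ⊎ b ≤ c
⊓-≤⁻ {a} {b} a⊓b≤c with ⊓-sel a b
... | inj₁ a⊓b≡a = inj₁ (subst (_≤ _) a⊓b≡a a⊓b≤c)
... | inj₂ a⊓b≡b = inj₂ (subst (_≤ _) a⊓b≡b a⊓b≤c)

module _ {Γ : Graph} {q : ℕ} (C : Cycle Γ q) (k : ℕ) (v : Fin (Graph.n Γ)) where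
  open Cycle C

  near : ℕ → Bool
  near j = within Γ k (vert j) v

  near-periodic : Periodic q near
  near-periodic j = cong (λ u → within Γ k u v) (periodic j)

  module _ (iso : Isometric Γ C) where

    private
      instance
        _ : NonZero q
        _ = >-nonZero (≤-trans (s≤s z≤n) len≥3)

      cycle-close : ∀ {i j} → i < q → j < q → near i ≡ true → near j ≡ true → cycDist Γ q i j ≤ k + k
      cycle-close i<q j<q near-i near-j = Dist⇒≤ Γ (iso _ _ i<q j<q) (within-trans Γ k k near-i (within-sym Γ k near-j))

      chords-from : ∀ {i} d → d < q → i < q → near i ≡ true → near (i + d) ≡ true → d ≤ k + k ⊎ q ∸ d ≤ k + k
      chords-from {i} d d<q i<q near-i near-i+d with i + d <? q
      ... | yes i+d<q = ⊓-≤⁻ (subst (_≤ k + k) (cong (λ z → z ⊓ (q ∸ z)) ∣i-[i+d]∣≡d) (cycle-close i<q i+d<q near-i near-i+d))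
        where
        ∣i-[i+d]∣≡d : ∣ i - i + d ∣ ≡ d
        ∣i-[i+d]∣≡d = trans (m≤n⇒∣m-n∣≡n∸m (m≤m+n i d)) (m+n∸m≡n i d)
      ... | no  i+d≮q = swap (⊓-≤⁻ (subst (_≤ k + k)
                                         (cong₂ _⊓_ ∣i-j∣≡q∸d (trans (cong (q ∸_) ∣i-j∣≡q∸d) (m∸[m∸n]≡n (<⇒≤ d<q))))
                                         (cycle-close i<q j<q near-i near-j)))
        where
        q≤i+d = ≮⇒≥ i+d≮q
        j = i + d ∸ q
        j+q≡i+d : j + q ≡ i + d
        j+q≡i+d = m∸n+n≡m q≤i+d
        j<q : j < q
        j<q = +-cancelʳ-< q j q (subst (_< q + q) (sym j+q≡i+d) (+-mono-< i<q d<q))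
        near-j : near j ≡ true
        near-j = trans (sym (periodic-∸ near-periodic q≤i+d)) near-i+d
        j≤i : j ≤ i
        j≤i = +-cancelʳ-≤ q j i (subst (_≤ i + q) (sym j+q≡i+d) (+-monoʳ-≤ i (<⇒≤ d<q)))
        ∣i-j∣≡q∸d : ∣ i - j ∣ ≡ q ∸ d
        ∣i-j∣≡q∸d = trans (m≤n⇒∣n-m∣≡n∸m j≤i) (+-cancelʳ-≡ d _ _ (begin
          i ∸ j + d          ≡⟨ +-∸-comm d j≤i ⟨
          i + d ∸ j          ≡⟨ cong (_∸ j) j+q≡i+d ⟨
          j + q ∸ j          ≡⟨ m+n∸m≡n j q ⟩
          q                  ≡⟨ m∸n+n≡m (<⇒≤ d<q) ⟨
          q ∸ d + d          ∎))
          where open ≡-Reasoning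

    -- Two cycle positions within distance k of v are within 2k in G, hence also along the isometric cycle.
    near-chords : ShortChords q near (k + k)
    near-chords x d d<q near-x near-x+d =
      chords-from d d<q (m%n<n x q) (trans (sym (periodic-% near-periodic x)) near-x)
                  (trans (sym (periodic-% (periodic-+ʳ near-periodic d) x)) near-x+d)

-- Non-backtracking walks and the girth

record NonBacktracking (Γ : Graph) (w : ℕ → Fin (Graph.n Γ)) (ℓ : ℕ) : Set where
  open Graph Γ using (adj)
  field
    step      : ∀ i → i < ℓ → adj (w i) (w (suc i)) ≡ true
    no-return : ∀ i → 2 + i ≤ ℓ → w i ≢ w (2 + i)

module _ {Γ : Graph} {g : ℕ} (girth≤ : ∀ ℓ → Cycle Γ ℓ → g ≤ ℓ) where
  open Graph Γ using (n; adj; irrefl)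

  module _ {w : ℕ → Fin n} {ℓ : ℕ} (nb : NonBacktracking Γ w ℓ) where
    open NonBacktracking nb

    segment-cycle : ∀ {a d} → 3 ≤ d → a + d ≤ ℓ → w a ≡ w (a + d) →
                    (∀ i j → i < j → j < d → w (a + i) ≢ w (a + j)) → Cycle Γ d
    segment-cycle {a} {d} 3≤d@(s≤s (s≤s (s≤s _))) a+d≤ℓ wa≡wa+d distinct = record
      { vert     = λ t → w (a + t % d)
      ; len≥3    = 3≤d
      ; periodic = λ t → cong (λ z → w (a + z)) ([m+n]%n≡m%n t d)
      ; inj      = λ i j i<d j<d eq → injective i j i<d j<d
                      (subst₂ (λ x y → w (a + x) ≡ w (a + y)) (m<n⇒m%n≡m i<d) (m<n⇒m%n≡m j<d) eq)
      ; edges    = edges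
      }
      where
      step-inside : ∀ i → suc i ≤ d → adj (w (a + i)) (w (a + suc i)) ≡ true
      step-inside i i<d = subst (λ z → adj (w (a + i)) (w z) ≡ true) (sym (+-suc a i))
                                (step (a + i) (subst (_≤ ℓ) (+-suc a i) (≤-trans (+-monoʳ-≤ a i<d) a+d≤ℓ)))
      injective : ∀ i j → i < d → j < d → w (a + i) ≡ w (a + j) → i ≡ j
      injective i j i<d j<d eq with <-cmp i j
      ... | tri< i<j _ _ = ⊥-elim (distinct i j i<j j<d eq)
      ... | tri≈ _ i≡j _ = i≡j
      ... | tri> _ _ j<i = ⊥-elim (distinct j i j<i i<d (sym eq))
      edges : ∀ t → adj (w (a + t % d)) (w (a + suc t % d)) ≡ true
      edges t with m≤n⇒m<n∨m≡n (m%n<n t d)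
      ... | inj₁ t%d+1<d = subst (λ z → adj (w (a + t % d)) (w (a + z)) ≡ true)
                                 (sym (trans (%-distribˡ-+ 1 t d) (m<n⇒m%n≡m t%d+1<d)))
                                 (step-inside (t % d) (<⇒≤ t%d+1<d))
      ... | inj₂ t%d+1≡d = subst (λ z → adj (w (a + t % d)) z ≡ true) wraps (step-inside (t % d) (≤-reflexive t%d+1≡d))
        where
        wraps : w (a + suc (t % d)) ≡ w (a + suc t % d)
        wraps = begin
          w (a + suc (t % d))      ≡⟨ cong (λ z → w (a + z)) t%d+1≡d ⟩
          w (a + d)                ≡⟨ wa≡wa+d ⟨
          w a                      ≡⟨ cong w (+-identityʳ a) ⟨
          w (a + 0)                ≡⟨ cong (λ z → w (a + z)) (trans (cong (_% d) t%d+1≡d) (n%n≡0 d)) ⟨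
          w (a + suc (t % d) % d)  ≡⟨ cong (λ z → w (a + z)) (%-distribˡ-+ 1 t d) ⟨
          w (a + suc t % d)        ∎
          where open ≡-Reasoning

    private
      Repeats : ℕ → Set
      Repeats d = 0 < d × ∃ λ a → a < suc ℓ × a + d ≤ ℓ × w a ≡ w (a + d)

      repeats? : Decidable Repeats
      repeats? d with anyUpTo? (λ a → (a + d ≤? ℓ) ×-dec (w a ≟ w (a + d))) (suc ℓ) | 0 <? d
      ... | yes (a , a≤ℓ , rep) | yes 0<d = yes (0<d , a , a≤ℓ , rep)
      ... | no  ¬rep            | _       = no λ (_ , a , a≤ℓ , rep) → ¬rep (a , a≤ℓ , rep)
      ... | _                   | no  d≡0 = no λ (0<d , _) → d≡0 0<d

      minimal-repeat-girth : ∀ {d} → Repeats d → (∀ d′ → d′ < d → ¬ Repeats d′) → g ≤ d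
      minimal-repeat-girth {1} (_ , a , _ , a+1≤ℓ , wa≡wa+1) _
        with () ← trans (sym (subst (λ z → adj (w a) z ≡ true) (sym (trans wa≡wa+1 (cong w (+-comm a 1))))
                                    (step a (subst (_≤ ℓ) (+-comm a 1) a+1≤ℓ))))
                        (irrefl (w a))
      minimal-repeat-girth {2} (_ , a , _ , a+2≤ℓ , wa≡wa+2) _ =
        ⊥-elim (no-return a (subst (_≤ ℓ) (+-comm a 2) a+2≤ℓ) (trans wa≡wa+2 (cong w (+-comm a 2))))
      minimal-repeat-girth {d@(suc (suc (suc _)))} (_ , a , _ , a+d≤ℓ , wa≡wa+d) minimal =
        girth≤ d (segment-cycle (s≤s (s≤s (s≤s z≤n))) a+d≤ℓ wa≡wa+d distinct)
        where
        distinct : ∀ i j → i < j → j < d → w (a + i) ≢ w (a + j)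
        distinct i j i<j j<d wai≡waj = minimal (j ∸ i) (≤-<-trans (m∸n≤m j i) j<d)
          (m<n⇒0<n∸m i<j , a + i , s≤s (≤-trans (m≤m+n (a + i) (j ∸ i)) a+i+[j∸i]≤ℓ) , a+i+[j∸i]≤ℓ ,
           trans wai≡waj (cong w (sym a+i+[j∸i]≡a+j)))
          where
          a+i+[j∸i]≡a+j : a + i + (j ∸ i) ≡ a + j
          a+i+[j∸i]≡a+j = trans (+-assoc a i (j ∸ i)) (cong (a +_) (m+[n∸m]≡n (<⇒≤ i<j)))
          a+i+[j∸i]≤ℓ : a + i + (j ∸ i) ≤ ℓ
          a+i+[j∸i]≤ℓ = subst (_≤ ℓ) (sym a+i+[j∸i]≡a+j) (≤-trans (+-monoʳ-≤ a (<⇒≤ j<d)) a+d≤ℓ)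

    repeat-girth : ∀ a d → 0 < d → a + d ≤ ℓ → w a ≡ w (a + d) → g ≤ d
    repeat-girth a d 0<d a+d≤ℓ wa≡wa+d
      with d₀ , d₀≤d , rep , minimal ← least repeats? (0<d , a , s≤s (≤-trans (m≤m+n a d) a+d≤ℓ) , a+d≤ℓ , wa≡wa+d)
      = ≤-trans (minimal-repeat-girth rep minimal) d₀≤d

module _ {A : Set} (w₁ : ℕ → A) (ℓ₁ : ℕ) (w₂ : ℕ → A) where

  joined : ℕ → A
  joined i = if i ≤ᵇ ℓ₁ then w₁ i else w₂ (i ∸ ℓ₁)

  joined-left : ∀ {i} → i ≤ ℓ₁ → joined i ≡ w₁ i
  joined-left {i} i≤ℓ₁ with i ≤ᵇ ℓ₁ | ≤⇒≤ᵇ i≤ℓ₁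
  ... | true | _ = refl

  joined-right : w₁ ℓ₁ ≡ w₂ 0 → ∀ {i} → ℓ₁ ≤ i → joined i ≡ w₂ (i ∸ ℓ₁)
  joined-right meet {i} ℓ₁≤i with i ≤ᵇ ℓ₁ in i≤ᵇℓ₁
  ... | false = refl
  ... | true with refl ← ≤-antisym ℓ₁≤i (≤ᵇ⇒≤ i ℓ₁ (subst T (sym i≤ᵇℓ₁) tt)) =
    trans meet (cong w₂ (sym (n∸n≡0 ℓ₁)))

module _ {Γ : Graph} where
  open Graph Γ using (n; adj) renaming (sym to adj-sym)

  reverse : ∀ {w ℓ} → NonBacktracking Γ w ℓ → NonBacktracking Γ (λ i → w (ℓ ∸ i)) ℓ
  reverse {w} {ℓ} nb = record
    { step      = λ i i<ℓ → subst (λ z → adj (w z) (w (ℓ ∸ suc i)) ≡ true) (sym (+-∸-assoc 1 i<ℓ))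
                              (trans (adj-sym _ _) (step (ℓ ∸ suc i) (∸-monoʳ-< z<s i<ℓ)))
    ; no-return = λ i 2+i≤ℓ eq → no-return (ℓ ∸ (2 + i)) (subst (_≤ ℓ) (sym (2+ℓ∸[2+i] 2+i≤ℓ)) (m∸n≤m ℓ i))
                                    (sym (trans (cong w (2+ℓ∸[2+i] 2+i≤ℓ)) eq))
    }
    where
    open NonBacktracking nb
    2+ℓ∸[2+i] : ∀ {i} → 2 + i ≤ ℓ → 2 + (ℓ ∸ (2 + i)) ≡ ℓ ∸ i
    2+ℓ∸[2+i] 2+i≤ℓ = sym (+-∸-assoc 2 2+i≤ℓ)

  join : ∀ {w₁ w₂ ℓ₁ ℓ₂} → NonBacktracking Γ w₁ ℓ₁ → NonBacktracking Γ w₂ ℓ₂ → w₁ ℓ₁ ≡ w₂ 0 → w₁ (ℓ₁ ∸ 1) ≢ w₂ 1 →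
         NonBacktracking Γ (joined w₁ ℓ₁ w₂) (ℓ₁ + ℓ₂)
  join {w₁} {w₂} {ℓ₁} {ℓ₂} nb₁ nb₂ meet turn = record { step = step ; no-return = no-return }
    where
    module ₁ = NonBacktracking nb₁
    module ₂ = NonBacktracking nb₂
    joined′ = joined w₁ ℓ₁ w₂
    left  = joined-left w₁ ℓ₁ w₂
    right = joined-right w₁ ℓ₁ w₂ meet
    step : ∀ i → i < ℓ₁ + ℓ₂ → adj (joined′ i) (joined′ (suc i)) ≡ true
    step i i<ℓ with suc i ≤? ℓ₁
    ... | yes i<ℓ₁ = subst₂ (λ a b → adj a b ≡ true) (sym (left (<⇒≤ i<ℓ₁))) (sym (left i<ℓ₁)) (₁.step i i<ℓ₁)
    ... | no  i≮ℓ₁ = subst₂ (λ a b → adj a b ≡ true) (sym (right ℓ₁≤i))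
                            (sym (trans (right (m≤n⇒m≤1+n ℓ₁≤i)) (cong w₂ (+-∸-assoc 1 ℓ₁≤i))))
                            (₂.step (i ∸ ℓ₁) (+-cancelˡ-< ℓ₁ _ _ (subst (_< ℓ₁ + ℓ₂) (sym (m+[n∸m]≡n ℓ₁≤i)) i<ℓ)))
      where ℓ₁≤i = ≤-pred (≰⇒> i≮ℓ₁)
    no-return : ∀ i → 2 + i ≤ ℓ₁ + ℓ₂ → joined′ i ≢ joined′ (2 + i)
    no-return i 2+i≤ℓ with 2 + i ≤? ℓ₁ | ℓ₁ ≤? i
    ... | yes 2+i≤ℓ₁ | _ = λ eq → ₁.no-return i 2+i≤ℓ₁
                                 (trans (sym (left (≤-trans (m≤n+m i 2) 2+i≤ℓ₁))) (trans eq (left 2+i≤ℓ₁)))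
    ... | no _       | yes ℓ₁≤i = λ eq → ₂.no-return (i ∸ ℓ₁) 2+[i∸ℓ₁]≤ℓ₂
                                 (trans (sym (right ℓ₁≤i))
                                   (trans eq (trans (right (≤-trans ℓ₁≤i (m≤n+m i 2))) (cong w₂ (+-∸-assoc 2 ℓ₁≤i)))))
      where
      2+[i∸ℓ₁]≤ℓ₂ : 2 + (i ∸ ℓ₁) ≤ ℓ₂
      2+[i∸ℓ₁]≤ℓ₂ = +-cancelˡ-≤ ℓ₁ _ _
                      (subst (_≤ ℓ₁ + ℓ₂) (sym (trans (+-comm ℓ₁ _) (cong (2 +_) (m∸n+n≡m ℓ₁≤i)))) 2+i≤ℓ)
    ... | no 2+i≰ℓ₁ | no ℓ₁≰i = λ eq → turn (trans (sym at-turn₁) (trans eq at-turn₂))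
      where
      ℓ₁≡1+i : ℓ₁ ≡ suc i
      ℓ₁≡1+i = ≤-antisym (≤-pred (≰⇒> 2+i≰ℓ₁)) (≰⇒> ℓ₁≰i)
      at-turn₁ : joined′ i ≡ w₁ (ℓ₁ ∸ 1)
      at-turn₁ = trans (left (<⇒≤ (≰⇒> ℓ₁≰i))) (cong w₁ (sym (cong (_∸ 1) ℓ₁≡1+i)))
      at-turn₂ : joined′ (2 + i) ≡ w₂ 1
      at-turn₂ = trans (right (≤-trans (≤-reflexive ℓ₁≡1+i) (n≤1+n (suc i))))
                       (trans (cong (λ z → w₂ (2 + i ∸ z)) ℓ₁≡1+i) (cong w₂ (m+n∸n≡m 1 i)))

Avoids : {A : Set} → Maybe A → A → Set
Avoids nothing  _ = ⊤
Avoids (just p) y = p ≢ y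

record Walk (Γ : Graph) (p : Maybe (Fin (Graph.n Γ))) (x v : Fin (Graph.n Γ)) (ℓ : ℕ) : Set where
  field
    w               : ℕ → Fin (Graph.n Γ)
    at-start        : w 0 ≡ x
    at-end          : w ℓ ≡ v
    nonBacktracking : NonBacktracking Γ w ℓ
    first-avoids    : 0 < ℓ → Avoids p (w 1)

module _ {Γ : Graph} {g : ℕ} (girth≤ : ∀ ℓ → Cycle Γ ℓ → g ≤ ℓ) where
  open Graph Γ using (n; adj)
  open Walk

  closed-walk-girth : ∀ {p x ℓ} → Walk Γ p x x ℓ → 0 < ℓ → g ≤ ℓ
  closed-walk-girth W 0<ℓ = repeat-girth girth≤ (nonBacktracking W) 0 _ 0<ℓ ≤-refl (trans (at-start W) (sym (at-end W)))

  diverging-walks-girth : ∀ {p p′ x v ℓ₁ ℓ₂} (W₁ : Walk Γ p x v ℓ₁) (W₂ : Walk Γ p′ x v ℓ₂) →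
                          0 < ℓ₁ → w W₁ 1 ≢ w W₂ 1 → g ≤ ℓ₁ + ℓ₂
  diverging-walks-girth {v = v} {ℓ₁} {ℓ₂} W₁ W₂ 0<ℓ₁ w₁1≢w₂1 =
    repeat-girth girth≤ (join (reverse (nonBacktracking W₁)) (nonBacktracking W₂) meet turn)
                 0 (ℓ₁ + ℓ₂) (≤-trans 0<ℓ₁ (m≤m+n ℓ₁ ℓ₂)) ≤-refl closed
    where
    back : ℕ → Fin n
    back i = w W₁ (ℓ₁ ∸ i)
    meet : back ℓ₁ ≡ w W₂ 0
    meet = trans (cong (w W₁) (n∸n≡0 ℓ₁)) (trans (at-start W₁) (sym (at-start W₂)))
    turn : back (ℓ₁ ∸ 1) ≢ w W₂ 1
    turn = subst (λ z → w W₁ z ≢ w W₂ 1) (sym (m∸[m∸n]≡n 0<ℓ₁)) w₁1≢w₂1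
    closed : joined back ℓ₁ (w W₂) 0 ≡ joined back ℓ₁ (w W₂) (ℓ₁ + ℓ₂)
    closed = begin
      joined back ℓ₁ (w W₂) 0          ≡⟨ joined-left back ℓ₁ (w W₂) z≤n ⟩
      w W₁ ℓ₁                          ≡⟨ at-end W₁ ⟩
      v                                ≡⟨ at-end W₂ ⟨
      w W₂ ℓ₂                          ≡⟨ cong (w W₂) (m+n∸m≡n ℓ₁ ℓ₂) ⟨
      w W₂ (ℓ₁ + ℓ₂ ∸ ℓ₁)              ≡⟨ joined-right back ℓ₁ (w W₂) meet (m≤m+n ℓ₁ ℓ₂) ⟨
      joined back ℓ₁ (w W₂) (ℓ₁ + ℓ₂)  ∎
      where open ≡-Reasoning

-- The Moore bound

geometric : ℕ → ℕ → ℕ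
geometric b zero    = 0
geometric b (suc m) = 1 + b * geometric b m

module _ {Γ : Graph} {g : ℕ} (girth≤ : ∀ ℓ → Cycle Γ ℓ → g ≤ ℓ) {δ : ℕ} (δ≤deg : ∀ u → δ ≤ deg Γ u) where
  open Graph Γ using (n; adj) renaming (sym to adj-sym)
  open Walk

  private
    ok : Maybe (Fin n) → Fin n → Fin n → Bool
    ok nothing  x y = adj x y
    ok (just p) x y = adj x y ∧ not ⌊ p ≟ y ⌋

    ok⇒adj : ∀ p {x y} → ok p x y ≡ true → adj x y ≡ true
    ok⇒adj nothing  x~y = x~y
    ok⇒adj (just p) ok  = ∧-conicalˡ _ _ ok

    ok⇒avoids : ∀ p {x y} → ok p x y ≡ true → Avoids p y
    ok⇒avoids nothing  _ = tt
    ok⇒avoids (just p) {x} ok refl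
      with () ← trans (sym ok) (trans (cong (λ b → adj x p ∧ not b) (⌊≟⌋-refl p)) (∧-zeroʳ (adj x p)))

    -- v is the end of a non-backtracking walk of length ≤ i from x whose first step avoids p
    Reach : Maybe (Fin n) → Fin n → ℕ → Fin n → Bool
    Reach p x zero    v = ⌊ x ≟ v ⌋
    Reach p x (suc i) v = ⌊ x ≟ v ⌋ ∨ any (λ y → ok p x y ∧ Reach (just x) y i v) (allFin n)

    stay : ∀ {p x} → Walk Γ p x x 0
    stay {x = x} = record
      { w = λ _ → x ; at-start = refl ; at-end = refl
      ; nonBacktracking = record { step = λ _ () ; no-return = λ _ () } ; first-avoids = λ () }

    prepend : ∀ {p x y v ℓ} → ok p x y ≡ true → Walk Γ (just x) y v ℓ → Walk Γ p x v (suc ℓ)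
    prepend {p} {x} {y} {v} {ℓ} x~y W = record
      { w               = w′
      ; at-start        = refl
      ; at-end          = at-end W
      ; nonBacktracking = record { step = step′ ; no-return = no-return′ }
      ; first-avoids    = λ _ → subst (Avoids p) (sym (at-start W)) (ok⇒avoids p x~y)
      }
      where
      open NonBacktracking (nonBacktracking W)
      w′ : ℕ → Fin n
      w′ zero    = x
      w′ (suc i) = w W i
      step′ : ∀ i → i < suc ℓ → adj (w′ i) (w′ (suc i)) ≡ true
      step′ zero    _         = subst (λ z → adj x z ≡ true) (sym (at-start W)) (ok⇒adj p x~y)
      step′ (suc i) (s≤s i<ℓ) = step i i<ℓ
      no-return′ : ∀ i → 2 + i ≤ suc ℓ → w′ i ≢ w′ (2 + i)
      no-return′ zero    (s≤s 1≤ℓ) = first-avoids W 1≤ℓ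
      no-return′ (suc i) (s≤s 2+i≤ℓ) = no-return i 2+i≤ℓ

    reach⇒walk : ∀ p x i v → Reach p x i v ≡ true → ∃ λ ℓ → ℓ ≤ i × Walk Γ p x v ℓ
    reach⇒walk p x zero    v reach with refl ← ⌊≟⌋⇒≡ reach = 0 , z≤n , stay
    reach⇒walk p x (suc i) v reach with x ≟ v
    ... | yes refl = 0 , z≤n , stay
    ... | no  _    with y , _ , x~y∧reach ← any-≡true⁻ _ (allFin n) reach
                           with ℓ , ℓ≤i , W ← reach⇒walk (just x) y i v (∧-conicalʳ _ _ x~y∧reach) =
      suc ℓ , s≤s ℓ≤i , prepend (∧-conicalˡ _ _ x~y∧reach) W

    reach⇒within : ∀ p x i v → Reach p x i v ≡ true → within Γ i x v ≡ true
    reach⇒within p x zero    v reach with refl ← ⌊≟⌋⇒≡ reach = ⌊≟⌋-refl x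
    reach⇒within p x (suc i) v reach with x ≟ v
    ... | yes refl = within-refl Γ (suc i) x
    ... | no  _    with y , _ , x~y∧reach ← any-≡true⁻ _ (allFin n) reach =
      within-trans Γ 1 i (within-step Γ 0 (⌊≟⌋-refl x) (ok⇒adj p (∧-conicalˡ _ _ x~y∧reach)))
                         (reach⇒within (just x) y i v (∧-conicalʳ _ _ x~y∧reach))

    reach-count : Maybe (Fin n) → Fin n → ℕ → ℕ
    reach-count p x i = countᵇ (Reach p x i) (allFin n)

    -- Below half the girth, the walks from x form a tree: branches through distinct first steps are disjoint.
    reach-count-suc : ∀ p x i → suc i + suc i < g →
      reach-count p x (suc i) ≡ 1 + sum (map (λ y → if ok p x y then reach-count (just x) y i else 0) (allFin n))
    reach-count-suc p x i 2i+2<g = begin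
      reach-count p x (suc i)
        ≡⟨ countᵇ-∨ not-back (allFin n) ⟩
      countᵇ (λ v → ⌊ x ≟ v ⌋) (allFin n) + countᵇ (λ v → any (λ y → branch y v) (allFin n)) (allFin n)
        ≡⟨ cong₂ _+_ (countᵇ-≟ x) (countᵇ-any branch (allFin n) (allFin n) (λ v → allFin-pairwise _ (branches-disjoint v))) ⟩
      1 + sum (map (λ y → countᵇ (branch y) (allFin n)) (allFin n))
        ≡⟨ cong (1 +_) (cong sum (map-cong (λ y → countᵇ-∧ˡ (ok p x y) (Reach (just x) y i) (allFin n)) (allFin n))) ⟩
      1 + sum (map (λ y → if ok p x y then reach-count (just x) y i else 0) (allFin n)) ∎
      where
      open ≡-Reasoning
      branch : Fin n → Fin n → Bool
      branch y v = ok p x y ∧ Reach (just x) y i v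
      short : ∀ {ℓ} → ℓ ≤ i → suc ℓ < g
      short ℓ≤i = ≤-<-trans (s≤s ℓ≤i) (≤-<-trans (m≤m+n (suc i) (suc i)) 2i+2<g)
      not-back : ∀ v → ⌊ x ≟ v ⌋ ≡ true → any (λ y → branch y v) (allFin n) ≡ true → ⊥
      not-back v x≡v reach
        with refl ← ⌊≟⌋⇒≡ x≡v
        with y , _ , ok∧reach ← any-≡true⁻ _ (allFin n) reach
        with ℓ , ℓ≤i , W ← reach⇒walk (just x) y i x (∧-conicalʳ _ _ ok∧reach) =
        <⇒≱ (short ℓ≤i) (closed-walk-girth girth≤ (prepend {p} (∧-conicalˡ _ _ ok∧reach) W) z<s)
      branches-disjoint : ∀ v y y′ → y ≢ y′ → branch y v ≡ true → branch y′ v ≡ true → ⊥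
      branches-disjoint v y y′ y≢y′ ok∧reach ok∧reach′
        with ℓ  , ℓ≤i  , W  ← reach⇒walk (just x) y  i v (∧-conicalʳ _ _ ok∧reach)
           | ℓ′ , ℓ′≤i , W′ ← reach⇒walk (just x) y′ i v (∧-conicalʳ _ _ ok∧reach′) =
        <⇒≱ (≤-<-trans (+-mono-≤ (s≤s ℓ≤i) (s≤s ℓ′≤i)) 2i+2<g)
            (diverging-walks-girth girth≤ (prepend {p} (∧-conicalˡ _ _ ok∧reach) W) (prepend {p} (∧-conicalˡ _ _ ok∧reach′) W′)
                                   z<s (λ eq → y≢y′ (trans (sym (at-start W)) (trans eq (at-start W′)))))

    branching : Maybe (Fin n) → ℕ
    branching nothing  = δ
    branching (just _) = δ ∸ 1

    branching≤ok : ∀ p x → branching p ≤ countᵇ (ok p x) (allFin n)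
    branching≤ok nothing  x = δ≤deg x
    branching≤ok (just p) x = begin
      δ ∸ 1                              ≤⟨ ∸-monoˡ-≤ 1 (δ≤deg x) ⟩
      deg Γ x ∸ 1                        ≤⟨ ∸-monoˡ-≤ 1 (countᵇ-≤-∧-not (adj x) (λ y → ⌊ p ≟ y ⌋) (allFin n)) ⟩
      count-ok + countᵇ (λ y → ⌊ p ≟ y ⌋) (allFin n) ∸ 1 ≡⟨ cong (λ c → count-ok + c ∸ 1) (countᵇ-≟ p) ⟩
      count-ok + 1 ∸ 1                   ≡⟨ m+n∸n≡m count-ok 1 ⟩
      count-ok                           ∎
      where
      open ≤-Reasoning
      count-ok = countᵇ (ok (just p) x) (allFin n)

    reach-count-≥ : ∀ i → i + i < g → ∀ p x → 1 + branching p * geometric (δ ∸ 1) i ≤ reach-count p x i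
    reach-count-≥ zero    _      p x = ≤-reflexive (trans (cong suc (*-zeroʳ (branching p))) (sym (countᵇ-≟ x)))
    reach-count-≥ (suc i) 2i+2<g p x = begin
      1 + branching p * geometric (δ ∸ 1) (suc i)
        ≤⟨ s≤s (*-monoˡ-≤ _ (branching≤ok p x)) ⟩
      1 + countᵇ (ok p x) (allFin n) * geometric (δ ∸ 1) (suc i)
        ≤⟨ s≤s (countᵇ*≤sum-map-if (ok p x) _ _ (λ y _ → reach-count-≥ i 2i<g (just x) y) (allFin n)) ⟩
      1 + sum (map (λ y → if ok p x y then reach-count (just x) y i else 0) (allFin n))
        ≡⟨ reach-count-suc p x i 2i+2<g ⟨
      reach-count p x (suc i) ∎
      where
      open ≤-Reasoning
      2i<g = ≤-<-trans (+-mono-≤ (n≤1+n i) (n≤1+n i)) 2i+2<g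

  moore-ball : ∀ k → k + k < g → ∀ x → 1 + δ * geometric (δ ∸ 1) k ≤ countᵇ (within Γ k x) (allFin n)
  moore-ball k 2k<g x = ≤-trans (reach-count-≥ k 2k<g nothing x) (countᵇ-mono (reach⇒within nothing x k) (allFin n))

  moore-edge-balls : ∀ k → suc (k + k) < g → ∀ {x x′} → adj x x′ ≡ true →
                     2 * geometric (δ ∸ 1) (suc k) ≤ countᵇ (λ v → within Γ k x v ∨ within Γ k x′ v) (allFin n)
  moore-edge-balls k 2k+1<g {x} {x′} x~x′ = begin
    2 * geometric (δ ∸ 1) (suc k)           ≡⟨ cong (geometric (δ ∸ 1) (suc k) +_) (+-identityʳ _) ⟩
    geometric (δ ∸ 1) (suc k) + geometric (δ ∸ 1) (suc k)
      ≤⟨ +-mono-≤ (reach-count-≥ k 2k<g (just x′) x) (reach-count-≥ k 2k<g (just x) x′) ⟩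
    reach-count (just x′) x k + reach-count (just x) x′ k
      ≡⟨ countᵇ-∨ sides-disjoint (allFin n) ⟨
    countᵇ (λ v → Reach (just x′) x k v ∨ Reach (just x) x′ k v) (allFin n)
      ≤⟨ countᵇ-mono reach⇒balls (allFin n) ⟩
    countᵇ (λ v → within Γ k x v ∨ within Γ k x′ v) (allFin n) ∎
    where
    open ≤-Reasoning
    2k<g = <-trans (n<1+n (k + k)) 2k+1<g
    reach⇒balls : ∀ v → (Reach (just x′) x k v ∨ Reach (just x) x′ k v) ≡ true → (within Γ k x v ∨ within Γ k x′ v) ≡ true
    reach⇒balls v reach with Reach (just x′) x k v in reach-x
    ... | true  rewrite reach⇒within (just x′) x k v reach-x = refl
    ... | false rewrite reach⇒within (just x) x′ k v reach = ∨-zeroʳ _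
    sides-disjoint : ∀ v → Reach (just x′) x k v ≡ true → Reach (just x) x′ k v ≡ true → ⊥
    sides-disjoint v reach reach′
      with ℓ , ℓ≤k , W ← reach⇒walk (just x′) x k v reach
         | ℓ′ , ℓ′≤k , W′ ← reach⇒walk (just x) x′ k v reach′
      = <⇒≱ (≤-<-trans (+-mono-≤ (s≤s ℓ≤k) ℓ′≤k) 2k+1<g) (via-edge ℓ′ W′)
      where
      W₊ : Walk Γ nothing x′ v (suc ℓ)
      W₊ = prepend {nothing} (trans (adj-sym x′ x) x~x′) W
      via-edge : ∀ ℓ′ → Walk Γ (just x) x′ v ℓ′ → g ≤ suc ℓ + ℓ′
      via-edge zero W′ with refl ← trans (sym (at-start W′)) (at-end W′) =
        subst (g ≤_) (sym (+-identityʳ (suc ℓ))) (closed-walk-girth girth≤ W₊ z<s)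
      via-edge (suc _) W′ = diverging-walks-girth girth≤ W₊ W′ z<s (λ eq → first-avoids W′ z<s (trans (sym (at-start W)) eq))

sumFrom-*ˡ : ∀ a m c (h : ℕ → ℕ) → sumFrom a m (λ i → c * h i) ≡ c * sumFrom a m h
sumFrom-*ˡ a zero    c h = sym (*-zeroʳ c)
sumFrom-*ˡ a (suc m) c h = trans (cong (c * h a +_) (sumFrom-*ˡ (suc a) m c h)) (sym (*-distribˡ-+ c (h a) _))

sumFrom-suc : ∀ a m (h : ℕ → ℕ) → sumFrom (suc a) m h ≡ sumFrom a m (h ∘ suc)
sumFrom-suc a zero    h = refl
sumFrom-suc a (suc m) h = cong (h (suc a) +_) (sumFrom-suc (suc a) m h)

geometric-sumFrom : ∀ b m → geometric b m ≡ sumFrom 0 m (b ^_)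
geometric-sumFrom b zero    = refl
geometric-sumFrom b (suc m) = cong suc (begin
  b * geometric b m              ≡⟨ cong (b *_) (geometric-sumFrom b m) ⟩
  b * sumFrom 0 m (b ^_)         ≡⟨ sumFrom-*ˡ 0 m b (b ^_) ⟨
  sumFrom 0 m (λ i → b ^ suc i)  ≡⟨ sumFrom-suc 0 m (b ^_) ⟨
  sumFrom 1 m (b ^_)             ∎)
  where open ≡-Reasoning

moore-odd : ∀ δ g → isOdd g ≡ true → moore δ g ≡ 1 + δ * geometric (δ ∸ 1) (kOf g)
moore-odd δ g odd rewrite odd =
  cong suc (trans (sumFrom-*ˡ 0 (kOf g) δ ((δ ∸ 1) ^_)) (cong (δ *_) (sym (geometric-sumFrom (δ ∸ 1) (kOf g)))))

moore-even : ∀ δ g → isOdd g ≡ false → moore δ g ≡ 2 * geometric (δ ∸ 1) (suc (kOf g))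
moore-even δ g even rewrite even = begin
  2 + sumFrom 1 k (λ i → 2 * b ^ i)  ≡⟨ cong (2 +_) (sumFrom-*ˡ 1 k 2 (b ^_)) ⟩
  2 + 2 * sumFrom 1 k (b ^_)         ≡⟨ *-distribˡ-+ 2 1 _ ⟨
  2 * (1 + sumFrom 1 k (b ^_))       ≡⟨ cong (2 *_) (geometric-sumFrom b (suc k)) ⟨
  2 * geometric b (suc k)            ∎
  where
  open ≡-Reasoning
  k = kOf g
  b = δ ∸ 1

odd-or-even : ∀ g → 0 < g → (isOdd g ≡ true × g ≡ suc (kOf g + kOf g)) ⊎ (isOdd g ≡ false × g ≡ suc (suc (kOf g + kOf g)))
odd-or-even (suc zero)          _ = inj₁ (refl , refl)
odd-or-even (suc (suc zero))    _ = inj₂ (refl , refl)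
odd-or-even (suc (suc (suc g))) _ with odd-or-even (suc g) z<s
... | inj₁ (odd  , g+1≡) = inj₁ (odd  , trans (cong (2 +_) g+1≡) (cong (2 +_) (sym (+-suc k k))))
  where k = kOf (suc g)
... | inj₂ (even , g+1≡) = inj₂ (even , trans (cong (2 +_) g+1≡) (cong (3 +_) (sym (+-suc k k))))
  where k = kOf (suc g)

-- Equatorial graphs

module _ {Γ : Graph} {q : ℕ} (C : Cycle Γ q) (iso : Isometric Γ C) {k : ℕ} (6k+3<q : 6 * k + 3 < q) where
  open Graph Γ using (n)
  open Cycle C

  Lsize-shift-invariant : ∀ {g a M} (E : ℕ → Fin n → Bool) →
                          (∀ v → Widening q (k + k) (near C k v) (λ j → E j v) g) →
                          (∀ j → M ≤ countᵇ (E j) (allFin n)) → n * g ≡ q * M → g ≡ k + suc a → a ≤ suc k →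
                          ∀ c → Lsize Γ k q C c ≡ Lsize Γ k q C (c + g)
  Lsize-shift-invariant {g} {a} {M} E widening E-large total g≡k+1+a a≤k+1 =
    count-shift-invariant (allFin n) E L (λ v → Widening.periodic (widening v)) perL g≡k+1+a k+g<q E-large
                          (trans (cong (_* g) (length-tabulate {n = n} (λ x → x))) total)
                          (λ v → proj₁ (profile v)) (λ v → proj₂ (profile v))
    where
    L : ℕ → Fin n → Bool
    L c v = near C k v (c + q ∸ k) ∧ near C k v (c + k)
    6k<q : k + k + (k + k) + (k + k) < q
    6k<q = ≤-<-trans (≤-trans (≤-reflexive (six k)) (m≤m+n (6 * k) 3)) 6k+3<q
      where
      six : ∀ k → k + k + (k + k) + (k + k) ≡ 6 * k
      six = solve-∀
    k+g<q : k + g < q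
    k+g<q = ≤-<-trans (begin
      k + g                  ≡⟨ cong (k +_) g≡k+1+a ⟩
      k + (k + suc a)        ≤⟨ +-monoʳ-≤ k (+-monoʳ-≤ k (s≤s a≤k+1)) ⟩
      k + (k + suc (suc k))  ≤⟨ ≤-reflexive (three k) ⟩
      3 * k + 2              ≤⟨ +-mono-≤ (*-mono-≤ {3} {6} (s≤s (s≤s (s≤s z≤n))) (≤-refl {k})) (n≤1+n 2) ⟩
      6 * k + 3              ∎) 6k+3<q
      where
      open ≤-Reasoning
      three : ∀ k → k + (k + suc (suc k)) ≡ 3 * k + 2
      three = solve-∀
    k≤q : k ≤ q
    k≤q = ≤-trans (m≤m+n k g) (<⇒≤ k+g<q)
    perL : ∀ v → Periodic q (λ c → L c v)
    perL v c = cong₂ _∧_ (trans (cong (near C k v) (+-∸-comm q (≤-trans k≤q (m≤n+m q c)))) (near-periodic C k v _))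
                         (periodic-+ʳ (near-periodic C k v) k c)
    profile = λ v → vertex-profile (near-periodic C k v) (near-chords C k v iso) 6k<q
                                   (subst (0 <_) (sym g≡k+1+a) (≤-trans (s≤s z≤n) (m≤n+m (suc a) k))) (widening v)

cycle-edge-back : ∀ {Γ q} (C : Cycle Γ q) j → Graph.adj Γ (Cycle.vert C (j + (q ∸ 1))) (Cycle.vert C j) ≡ true
cycle-edge-back {Γ} {q} C j =
  subst (λ u → Graph.adj Γ (vert (j + (q ∸ 1))) u ≡ true) (trans (cong vert j+q) (periodic j)) (edges (j + (q ∸ 1)))
  where
  open Cycle C
  j+q : suc (j + (q ∸ 1)) ≡ j + q
  j+q = trans (sym (+-suc j (q ∸ 1))) (cong (j +_) (trans (+-comm 1 (q ∸ 1)) (m∸n+n≡m (≤-trans (s≤s z≤n) len≥3))))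

1+2k<q : ∀ {k q} → 6 * k + 3 < q → suc (k + k) < q
1+2k<q {k} 6k+3<q = ≤-<-trans (subst (suc (k + k) ≤_) (split k) (m≤m+n _ (4 * k + 2))) 6k+3<q
  where
  split : ∀ k → suc (k + k) + (4 * k + 2) ≡ 6 * k + 3
  split = solve-∀

lemma24 : (G : Graph) (δ g q : ℕ) → Equatorial G δ g q →
    (C : Cycle G q) → Isometric G C →
    ∀ i → i < q → Lsize G (kOf g) q C i ≡ Lsize G (kOf g) q C (i + g)
lemma24 G δ g q (_ , 3≤g , (δ≤deg , _) , (_ , girth≤) , _ , 6k+3<q , total) C iso i _
  with odd-or-even g (≤-trans (s≤s z≤n) 3≤g)
... | inj₁ (odd , g≡1+2k) =
  Lsize-shift-invariant C iso 6k+3<q (λ j v → near C k v j)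
    (λ v → subst (Widening q (k + k) _ _) (sym g≡1+2k) (identity-widening (near-periodic C k v) 2k<q))
    (λ j → ≤-trans (≤-reflexive (moore-odd δ g odd)) (moore-ball girth≤ δ≤deg k (≤-reflexive (sym g≡1+2k)) (Cycle.vert C j)))
    total (trans g≡1+2k (sym (+-suc k k))) (n≤1+n k) i
  where
  k = kOf g
  2k<q = <-trans (n<1+n (k + k)) (1+2k<q {k} 6k+3<q)
... | inj₂ (even , g≡2+2k) =
  Lsize-shift-invariant C iso 6k+3<q (λ j v → near C k v (j + (q ∸ 1)) ∨ near C k v j)
    (λ v → subst (Widening q (k + k) _ _) (sym g≡2+2k) (edge-widening (near-periodic C k v) 2k<q (1+2k<q {k} 6k+3<q)))
    (λ j → ≤-trans (≤-reflexive (moore-even δ g even))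
                   (moore-edge-balls girth≤ δ≤deg k (≤-reflexive (sym g≡2+2k)) (cycle-edge-back C j)))
    total (trans g≡2+2k (sym (trans (+-suc k (suc k)) (cong suc (+-suc k k))))) ≤-refl i
  where
  k = kOf g
  2k<q = <-trans (n<1+n (k + k)) (1+2k<q {k} 6k+3<q)
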